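{- Let $S,P,Q$ be pairwise disjoint finite sets and $\mathcal M_{SP},\mathcal M_{PQ}$ matroids on $S\uplus P$, $P\uplus Q$. Then $$r(\mathcal M_{SP}\vee\mathcal M_{PQ})-r(\mathcal M_{SP}\wedge\mathcal M_{PQ})=r((\mathcal M_{SP}\vee\mathcal M_{PQ})\circ P)-r((\mathcal M_{SP}\wedge\mathcal M_{PQ})\times P).$$
   Context: For a matroid $\mathcal M$ on $X$ and $T\subseteq X$: $\mathcal M\circ T$ is the restriction to $T$ (delete $X-T$), $\mathcal M\times T$ the contraction to $T$ (contract $X-T$); $r(\cdot)$ is the rank. $\mathbf 0_X$ (resp. $\mathbf F_X$) is the matroid on $X$ whose only base is $\emptyset$ (resp. $X$). For matroids $\mathcal M_1,\mathcal M_2$ on the same set, $\mathcal M_1\vee\mathcal M_2$ has as bases the maximal sets $b_1\cup b_2$, and $\mathcal M_1\wedge\mathcal M_2$ has as bases the minimal sets $b_1\cap b_2$, where $b_i$ ranges over bases of $\mathcal M_i$. For $S,P,Q$ pairwise disjoint: $\mathcal M_{SP}\vee\mathcal M_{PQ}:=(\mathcal M_{SP}\oplus\mathbf 0_Q)\vee(\mathcal M_{PQ}\oplus\mathbf 0_S)$ and $\mathcal M_{SP}\wedge\mathcal M_{PQ}:=(\mathcal M_{SP}\oplus\mathbf F_Q)\wedge(\mathcal M_{PQ}\oplus\mathbf F_S)$, both matroids on $S\uplus P\uplus Q$. -}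

module Defs where

open import Data.Bool using (Bool; true; false; _∧_; _∨_; not; T)
open import Data.Nat using (ℕ; zero; suc; _⊔_)
open import Data.Fin using (Fin)
open import Data.Fin.Subset using (Subset; _∈_; _∉_; _⊆_; _∪_; _∩_; _─_; ∁; ⁅_⁆; ∣_∣; ⊤; ⊥; Empty)
open import Data.Vec using (Vec; []; _∷_)
open import Data.List using (List; []; _∷_; map; _++_; foldr)
open import Data.Bool.ListAction using (any)
open import Data.Product using (Σ; ∃; _×_; _,_)
open import Relation.Binary.PropositionalEquality using (_≡_)

subB : ∀ {n} → Subset n → Subset n → Bool
subB [] [] = true
subB (x ∷ xs) (y ∷ ys) = (not x ∨ y) ∧ subB xs ys

eqB : ∀ {n} → Subset n → Subset n → Bool
eqB a b = subB a b ∧ subB b a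

ssubB : ∀ {n} → Subset n → Subset n → Bool
ssubB a b = subB a b ∧ not (subB b a)

allSubsets : (n : ℕ) → List (Subset n)
allSubsets zero = [] ∷ []
allSubsets (suc n) = map (true ∷_) (allSubsets n) ++ map (false ∷_) (allSubsets n)

record SetSystem (n : ℕ) : Set where
  constructor mkSS
  field
    ground : Subset n
    isBase : Subset n → Bool
open SetSystem public

record IsMatroid {n : ℕ} (M : SetSystem n) : Set where
  field
    bases-in-ground : ∀ b → T (isBase M b) → b ⊆ ground M
    base-exists     : ∃ λ b → T (isBase M b)
    exchange        : ∀ b₁ b₂ → T (isBase M b₁) → T (isBase M b₂) →
                      ∀ x → x ∈ b₁ → x ∉ b₂ →
                      ∃ λ y → y ∈ b₂ × y ∉ b₁ × T (isBase M ((b₁ ─ ⁅ x ⁆) ∪ ⁅ y ⁆))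

record Matroid (n : ℕ) (E : Subset n) : Set where
  field
    sys      : SetSystem n
    ground≡  : ground sys ≡ E
    matroid  : IsMatroid sys
open Matroid public

maximalIn : ∀ {n} → (Subset n → Bool) → Subset n → Bool
maximalIn {n} p b = p b ∧ not (any (λ c → p c ∧ ssubB b c) (allSubsets n))

minimalIn : ∀ {n} → (Subset n → Bool) → Subset n → Bool
minimalIn {n} p b = p b ∧ not (any (λ c → p c ∧ ssubB c b) (allSubsets n))

imageOf : ∀ {n} → (Subset n → Bool) → (Subset n → Subset n) → Subset n → Bool
imageOf {n} p f c = any (λ b → p b ∧ eqB (f b) c) (allSubsets n)

image₂Of : ∀ {n} → (Subset n → Bool) → (Subset n → Bool) →
           (Subset n → Subset n → Subset n) → Subset n → Bool
image₂Of {n} p₁ p₂ g c =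
  any (λ b₁ → any (λ b₂ → p₁ b₁ ∧ p₂ b₂ ∧ eqB (g b₁ b₂) c) (allSubsets n)) (allSubsets n)

-- Direct sums with 0_Q (only base ∅) and F_Q (only base Q).
_⊕0_ : ∀ {n} → SetSystem n → Subset n → SetSystem n
M ⊕0 Q = mkSS (ground M ∪ Q) (isBase M)

_⊕F_ : ∀ {n} → SetSystem n → Subset n → SetSystem n
M ⊕F Q = mkSS (ground M ∪ Q) (imageOf (isBase M) (λ b → b ∪ Q))

_∨M_ : ∀ {n} → SetSystem n → SetSystem n → SetSystem n
M₁ ∨M M₂ = mkSS (ground M₁) (maximalIn (image₂Of (isBase M₁) (isBase M₂) _∪_))

_∧M_ : ∀ {n} → SetSystem n → SetSystem n → SetSystem n
M₁ ∧M M₂ = mkSS (ground M₁) (minimalIn (image₂Of (isBase M₁) (isBase M₂) _∩_))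

joinSPQ : ∀ {n} (S Q : Subset n) → SetSystem n → SetSystem n → SetSystem n
joinSPQ S Q MSP MPQ = (MSP ⊕0 Q) ∨M (MPQ ⊕0 S)

meetSPQ : ∀ {n} (S Q : Subset n) → SetSystem n → SetSystem n → SetSystem n
meetSPQ S Q MSP MPQ = (MSP ⊕F Q) ∧M (MPQ ⊕F S)

dual : ∀ {n} → SetSystem n → SetSystem n
dual M = mkSS (ground M) (λ c → subB c (ground M) ∧ isBase M (ground M ─ c))

-- Restriction M ∘ T (delete ground − T): bases are the maximal independent
-- sets contained in T, i.e. the maximal sets of the form b ∩ T.
restrict : ∀ {n} → SetSystem n → Subset n → SetSystem n
restrict M T′ = mkSS T′ (maximalIn (imageOf (isBase M) (λ b → b ∩ T′)))

-- Contraction M × T (contract ground − T): (M* ∘ T)*.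
contract : ∀ {n} → SetSystem n → Subset n → SetSystem n
contract M T′ = dual (restrict (dual M) T′)

-- Rank of a set system: the size of a base (taken as the maximum base size;
-- for a matroid all bases have the same size).
rank : ∀ {n} → SetSystem n → ℕ
rank {n} M = foldr (λ b r → if-base b r) 0 (allSubsets n)
  where
  if-base : Subset n → ℕ → ℕ
  if-base b r with isBase M b
  ... | true  = ∣ b ∣ ⊔ r
  ... | false = r

module Submission where

-- For bases a of M_SP and c of M_PQ, the bases of M_SP ∨ M_PQ are the maximal sets a ∪ c and those
-- of M_SP ∧ M_PQ the minimal sets (a ∪ Q) ∩ (c ∪ S); restricting the first to P and contracting the
-- second to P, the four ranks are max ∣a ∪ c∣, max ∣(a ∪ c) ∩ P∣, min ∣(a ∪ Q) ∩ (c ∪ S)∣ and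
-- min ∣a ∩ c∣. Both ∣a ∪ c∣ + ∣a ∩ c∣ and ∣(a ∪ c) ∩ P∣ + ∣(a ∪ Q) ∩ (c ∪ S)∣ equal ∣a∣ + ∣c∣, which
-- does not depend on the pair, so r(M_SP ∨ M_PQ) + r((M_SP ∧ M_PQ) × P) and
-- r((M_SP ∨ M_PQ) ∘ P) + r(M_SP ∧ M_PQ) are both equal to it.
--
-- The maxima are immediate. The minima need matroid theory: the complement of (a ∪ Q) ∩ (c ∪ S) is
-- a* ∪ c*, the union of bases of the duals, so inclusion-minimal such sets complement maximal
-- independent sets of the union matroid M_SP* ∨ M_PQ* and are therefore of minimum size (likewise
-- inside P). That the union of two matroids is a matroid is shown by identifying, one element at a
-- time, the two copies of the ground set in their direct sum.

open import Defs
open import Function using (_∘_; id; Equivalence)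
open import Data.Bool using (Bool; true; false; _∧_; _∨_; not; T)
open import Data.Bool.Properties using (T-∧; ∧-zeroʳ; ∧-identityʳ; ∨-zeroʳ; ∨-identityʳ)
open import Data.Bool.ListAction using (any)
open import Data.Unit using (tt)
open import Data.Empty using (⊥-elim) renaming (⊥ to ⊥₀)
open import Data.Nat using (ℕ; zero; suc; _+_; _≤_; _<_; _⊔_; z≤n; _≤?_; _<?_)
open import Data.Nat.Properties hiding (_≟_)
open import Algebra.Properties.CommutativeSemigroup +-commutativeSemigroup using (interchange)
open import Data.Fin using (Fin; zero; suc; _≟_; _↑ˡ_; _↑ʳ_; splitAt)
open import Data.Fin.Properties using (any?; splitAt-↑ˡ; splitAt-↑ʳ; ↑ˡ-injective; ↑ʳ-injective)
open import Data.Fin.Subset hiding (_-_)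
open import Data.Fin.Subset.Properties
open import Data.Fin.Subset.Induction using (Acc; acc; ⊂-wellFounded; ⊃-wellFounded)
import Data.Vec as Vec
open import Data.Vec using ([]; _∷_; _++_; lookup; here; there)
open import Data.Vec.Properties
  using ([]=⇒lookup; lookup⇒[]=; lookup-zipWith; lookup-replicate; lookup-++ˡ; lookup-++ʳ; zipWith-++;
         ++-injectiveˡ; tabulate∘lookup; tabulate-cong)
open import Data.List using ([]; _∷_; map; foldr)
open import Data.List.Membership.Propositional using (lose) renaming (_∈_ to _∈ˡ_)
open import Data.List.Membership.Propositional.Properties using (∈-++⁺ˡ; ∈-++⁺ʳ; ∈-map⁺)
open import Data.List.Relation.Unary.Any using (satisfied) renaming (here to hereˡ; there to thereˡ)
open import Data.List.Relation.Unary.Any.Properties using (any⁺; any⁻)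
open import Data.Product using (Σ; ∃; ∃₂; _×_; _,_; proj₁; proj₂)
open import Data.Sum using (_⊎_; inj₁; inj₂; [_,_]′) renaming (map to map-⊎)
open import Data.Integer using (+_; _-_; _⊖_)
open import Data.Integer.Properties using ([+m]-[+n]≡m⊖n; +-cancelˡ-⊖)
open import Relation.Nullary using (¬_; Dec; yes; no; ¬?)
open import Relation.Nullary.Decidable using (T?; decidable-stable; _×-dec_)
open import Relation.Binary.PropositionalEquality hiding (J)

private
  variable
    n : ℕ
    p q r s : Subset n
    x y : Fin n

∈⇒lookup : x ∈ p → lookup p x ≡ true
∈⇒lookup = []=⇒lookup

lookup⇒∈ : lookup p x ≡ true → x ∈ p
lookup⇒∈ {p = p} {x = x} = lookup⇒[]= x p

∉⇒lookup : x ∉ p → lookup p x ≡ false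
∉⇒lookup {x = x} {p = p} x∉p with lookup p x in eq
... | true  = ⊥-elim (x∉p (lookup⇒∈ eq))
... | false = refl

lookup⇒∉ : lookup p x ≡ false → x ∉ p
lookup⇒∉ eq x∈p with trans (sym (∈⇒lookup x∈p)) eq
... | ()

⊆⇒lookup : p ⊆ q → lookup p x ≡ true → lookup q x ≡ true
⊆⇒lookup p⊆q = ∈⇒lookup ∘ p⊆q ∘ lookup⇒∈

lookup-ext : (∀ i → lookup p i ≡ lookup q i) → p ≡ q
lookup-ext {p = p} {q = q} eq =
  trans (sym (tabulate∘lookup p)) (trans (tabulate-cong eq) (tabulate∘lookup q))

lookup-∪ : ∀ (p q : Subset n) i → lookup (p ∪ q) i ≡ (lookup p i ∨ lookup q i)
lookup-∪ p q i = lookup-zipWith _∨_ i p q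

lookup-∩ : ∀ (p q : Subset n) i → lookup (p ∩ q) i ≡ (lookup p i ∧ lookup q i)
lookup-∩ p q i = lookup-zipWith _∧_ i p q

lookup-─ : ∀ (p q : Subset n) i → lookup (p ─ q) i ≡ (lookup p i ∧ not (lookup q i))
lookup-─ (s ∷ p) (true  ∷ q) zero    = sym (∧-zeroʳ s)
lookup-─ (s ∷ p) (false ∷ q) zero    = sym (∧-identityʳ s)
lookup-─ (s ∷ p) (_     ∷ q) (suc i) = lookup-─ p q i

lookup-⊤ : ∀ (i : Fin n) → lookup ⊤ i ≡ true
lookup-⊤ i = lookup-replicate i true

lookup-⊥ : ∀ (i : Fin n) → lookup ⊥ i ≡ false
lookup-⊥ i = lookup-replicate i false

⊈⇒∃ : ¬ (p ⊆ q) → ∃ λ x → x ∈ p × x ∉ q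
⊈⇒∃ {p = p} {q = q} p⊈q with any? (λ x → x ∈? p ×-dec ¬? (x ∈? q))
... | yes found = found
... | no  none  = ⊥-elim (p⊈q λ {x} x∈p →
                    decidable-stable (x ∈? q) (λ x∉q → none (x , x∈p , x∉q)))

x∈p─q⁻ : x ∈ p ─ q → x ∈ p × x ∉ q
x∈p─q⁻ {x = x} {p = p} {q = q} x∈p─q
  with lookup p x in px | lookup q x in qx | trans (sym (lookup-─ p q x)) (∈⇒lookup x∈p─q)
... | true  | false | _  = lookup⇒∈ px , lookup⇒∉ qx
... | true  | true  | ()
... | false | _     | ()

─-mono : p ⊆ q → p ─ r ⊆ q ─ r
─-mono p⊆q z∈ = x∈p∧x∉q⇒x∈p─q (p⊆q (proj₁ (x∈p─q⁻ z∈))) (proj₂ (x∈p─q⁻ z∈))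

─-antimono : q ⊆ r → p ─ r ⊆ p ─ q
─-antimono q⊆r z∈ = let z∈p , z∉r = x∈p─q⁻ z∈ in x∈p∧x∉q⇒x∈p─q z∈p (z∉r ∘ q⊆r)

─-reflects-⊆ : ∀ {p q r : Subset n} → p ─ q ⊆ p ─ r → r ⊆ p → r ⊆ q
─-reflects-⊆ {q = q} p─q⊆p─r r⊆p {z} z∈r =
  decidable-stable (z ∈? q) λ z∉q → proj₂ (x∈p─q⁻ (p─q⊆p─r (x∈p∧x∉q⇒x∈p─q (r⊆p z∈r) z∉q))) z∈r

∪-⊆ : p ⊆ r → q ⊆ r → p ∪ q ⊆ r
∪-⊆ {p = p} {q = q} p⊆r q⊆r x∈p∪q = [ p⊆r , q⊆r ]′ (x∈p∪q⁻ p q x∈p∪q)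

⊆-∩ : r ⊆ p → r ⊆ q → r ⊆ p ∩ q
⊆-∩ r⊆p r⊆q x∈r = x∈p∩q⁺ (r⊆p x∈r , r⊆q x∈r)

∪-mono : p ⊆ q → r ⊆ s → p ∪ r ⊆ q ∪ s
∪-mono {q = q} {s = s} p⊆q r⊆s = ∪-⊆ (⊆-trans p⊆q (p⊆p∪q s)) (⊆-trans r⊆s (q⊆p∪q q s))

⁅x⁆⊆ : x ∈ p → ⁅ x ⁆ ⊆ p
⁅x⁆⊆ {x = x} x∈p y∈⁅x⁆ rewrite x∈⁅y⁆⇒x≡y x y∈⁅x⁆ = x∈p

x∈p∪⁅x⁆ : ∀ (p : Subset n) x → x ∈ p ∪ ⁅ x ⁆
x∈p∪⁅x⁆ p x = q⊆p∪q p ⁅ x ⁆ (x∈⁅x⁆ x)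

p⊂p∪⁅x⁆ : x ∉ p → p ⊂ p ∪ ⁅ x ⁆
p⊂p∪⁅x⁆ {x = x} {p = p} x∉p = p⊆p∪q ⁅ x ⁆ , x , x∈p∪⁅x⁆ p x , x∉p

⊆-─⁅x⁆ : p ⊆ q → x ∉ p → p ⊆ q ─ ⁅ x ⁆
⊆-─⁅x⁆ p⊆q x∉p y∈p = x∈p∧x≢y⇒x∈p-y (p⊆q y∈p) λ { refl → x∉p y∈p }

p∩q∪p─q≡p : ∀ (p q : Subset n) → (p ∩ q) ∪ (p ─ q) ≡ p
p∩q∪p─q≡p []          []          = refl
p∩q∪p─q≡p (true  ∷ p) (true  ∷ q) = cong (true ∷_)  (p∩q∪p─q≡p p q)
p∩q∪p─q≡p (true  ∷ p) (false ∷ q) = cong (true ∷_)  (p∩q∪p─q≡p p q)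
p∩q∪p─q≡p (false ∷ p) (true  ∷ q) = cong (false ∷_) (p∩q∪p─q≡p p q)
p∩q∪p─q≡p (false ∷ p) (false ∷ q) = cong (false ∷_) (p∩q∪p─q≡p p q)

p─[p─q]≡q : ∀ (p q : Subset n) → q ⊆ p → p ─ (p ─ q) ≡ q
p─[p─q]≡q []          []          _   = refl
p─[p─q]≡q (true  ∷ p) (true  ∷ q) q⊆p = cong (true  ∷_) (p─[p─q]≡q p q (drop-∷-⊆ q⊆p))
p─[p─q]≡q (true  ∷ p) (false ∷ q) q⊆p = cong (false ∷_) (p─[p─q]≡q p q (drop-∷-⊆ q⊆p))
p─[p─q]≡q (false ∷ p) (false ∷ q) q⊆p = cong (false ∷_) (p─[p─q]≡q p q (drop-∷-⊆ q⊆p))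
p─[p─q]≡q (false ∷ p) (true  ∷ q) q⊆p with q⊆p here
... | ()

rename : Fin n → Fin n → Subset n → Subset n
rename a b J = (J ─ ⁅ a ⁆) ∪ ⁅ b ⁆

module _ {a b : Fin n} (J : Subset n) where

  lookup-rename-source : a ≢ b → lookup (rename a b J) a ≡ false
  lookup-rename-source a≢b
    rewrite lookup-∪ (J ─ ⁅ a ⁆) ⁅ b ⁆ a | lookup-─ J ⁅ a ⁆ a | ∈⇒lookup (x∈⁅x⁆ a)
          | ∉⇒lookup (x≢y⇒x∉⁅y⁆ a≢b) | ∧-zeroʳ (lookup J a) = refl

  lookup-rename-target : lookup (rename a b J) b ≡ true
  lookup-rename-target rewrite lookup-∪ (J ─ ⁅ a ⁆) ⁅ b ⁆ b | ∈⇒lookup (x∈⁅x⁆ b) = ∨-zeroʳ _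

  lookup-rename-other : ∀ {i} → i ≢ a → i ≢ b → lookup (rename a b J) i ≡ lookup J i
  lookup-rename-other {i} i≢a i≢b
    rewrite lookup-∪ (J ─ ⁅ a ⁆) ⁅ b ⁆ i | lookup-─ J ⁅ a ⁆ i
          | ∉⇒lookup (x≢y⇒x∉⁅y⁆ i≢a) | ∉⇒lookup (x≢y⇒x∉⁅y⁆ i≢b)
          | ∧-identityʳ (lookup J i) = ∨-identityʳ _

  rename⊆∪⁅⁆ : rename a b J ⊆ J ∪ ⁅ b ⁆
  rename⊆∪⁅⁆ = ∪-mono (p─q⊆p J ⁅ a ⁆) ⊆-refl

  rename-∪⁅⁆⊆ : rename a b (J ∪ ⁅ a ⁆) ⊆ J ∪ ⁅ b ⁆
  rename-∪⁅⁆⊆ = ∪-mono (λ z∈ → let z∈J+a , z∉⁅a⁆ = x∈p─q⁻ z∈ in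
                         [ id , ⊥-elim ∘ z∉⁅a⁆ ]′ (x∈p∪q⁻ J ⁅ a ⁆ z∈J+a)) ⊆-refl

  ⊆rename∪⁅⁆ : J ⊆ rename a b J ∪ ⁅ a ⁆
  ⊆rename∪⁅⁆ {z} z∈J with z ≟ a
  ... | yes refl = q⊆p∪q _ ⁅ a ⁆ (x∈⁅x⁆ a)
  ... | no  z≢a  = p⊆p∪q ⁅ a ⁆ (p⊆p∪q ⁅ b ⁆ (x∈p∧x≢y⇒x∈p-y z∈J z≢a))

─-rename : ∀ (p q : Subset n) → x ∈ p → x ≢ y → p ─ rename x y q ≡ rename y x (p ─ q)
─-rename {x = x} {y = y} p q x∈p x≢y = lookup-ext pointwise
  where
  pointwise : ∀ i → lookup (p ─ rename x y q) i ≡ lookup (rename y x (p ─ q)) i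
  pointwise i with i ≟ x | i ≟ y
  ... | yes refl | _ = begin
    lookup (p ─ rename x y q) x                ≡⟨ lookup-─ p (rename x y q) x ⟩
    lookup p x ∧ not (lookup (rename x y q) x)
      ≡⟨ cong₂ (λ a b → a ∧ not b) (∈⇒lookup x∈p) (lookup-rename-source q x≢y) ⟩
    true                                       ≡⟨ lookup-rename-target (p ─ q) ⟨
    lookup (rename y x (p ─ q)) x              ∎
    where open ≡-Reasoning
  ... | no _ | yes refl = begin
    lookup (p ─ rename x y q) y                ≡⟨ lookup-─ p (rename x y q) y ⟩
    lookup p y ∧ not (lookup (rename x y q) y) ≡⟨ cong (λ b → lookup p y ∧ not b) (lookup-rename-target q) ⟩
    lookup p y ∧ false                         ≡⟨ ∧-zeroʳ _ ⟩
    false                                      ≡⟨ lookup-rename-source (p ─ q) (x≢y ∘ sym) ⟨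
    lookup (rename y x (p ─ q)) y              ∎
    where open ≡-Reasoning
  ... | no i≢x | no i≢y = begin
    lookup (p ─ rename x y q) i                ≡⟨ lookup-─ p (rename x y q) i ⟩
    lookup p i ∧ not (lookup (rename x y q) i) ≡⟨ cong (λ b → lookup p i ∧ not b) (lookup-rename-other q i≢x i≢y) ⟩
    lookup p i ∧ not (lookup q i)              ≡⟨ lookup-─ p q i ⟨
    lookup (p ─ q) i                           ≡⟨ lookup-rename-other (p ─ q) i≢y i≢x ⟨
    lookup (rename y x (p ─ q)) i              ∎
    where open ≡-Reasoning

rename-─⊂ : x ∈ p → x ∉ q → y ∈ q → rename x y p ─ q ⊂ p ─ q
rename-─⊂ {x = x} {p = p} {q = q} {y = y} x∈p x∉q y∈q =
  shrinks , x , x∈p∧x∉q⇒x∈p─q x∈p x∉q , lookup⇒∉ (lookup-rename-source p x≢y) ∘ proj₁ ∘ x∈p─q⁻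
  where
  x≢y : x ≢ y
  x≢y refl = x∉q y∈q
  shrinks : rename x y p ─ q ⊆ p ─ q
  shrinks {z} z∈ with x∈p─q⁻ z∈
  ... | z∈rename , z∉q with x∈p∪q⁻ p ⁅ y ⁆ (rename⊆∪⁅⁆ p z∈rename)
  ...   | inj₁ z∈p   = x∈p∧x∉q⇒x∈p─q z∈p z∉q
  ...   | inj₂ z∈⁅y⁆ rewrite x∈⁅y⁆⇒x≡y y z∈⁅y⁆ = ⊥-elim (z∉q y∈q)

∣p∪⁅x⁆∣≡1+∣p∣ : x ∉ p → ∣ p ∪ ⁅ x ⁆ ∣ ≡ suc ∣ p ∣
∣p∪⁅x⁆∣≡1+∣p∣ {x = zero}  {p = true  ∷ p} x∉p = ⊥-elim (x∉p here)
∣p∪⁅x⁆∣≡1+∣p∣ {x = zero}  {p = false ∷ p} _   = cong (suc ∘ ∣_∣) (∪-identityʳ p)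
∣p∪⁅x⁆∣≡1+∣p∣ {x = suc x} {p = true  ∷ p} x∉p = cong suc (∣p∪⁅x⁆∣≡1+∣p∣ (x∉p ∘ there))
∣p∪⁅x⁆∣≡1+∣p∣ {x = suc x} {p = false ∷ p} x∉p = ∣p∪⁅x⁆∣≡1+∣p∣ (x∉p ∘ there)

1+∣p─⁅x⁆∣≡∣p∣ : x ∈ p → suc ∣ p ─ ⁅ x ⁆ ∣ ≡ ∣ p ∣
1+∣p─⁅x⁆∣≡∣p∣ {x = zero}  {p = true  ∷ p} here        = cong (suc ∘ ∣_∣) (p─⊥≡p p)
1+∣p─⁅x⁆∣≡∣p∣ {x = suc x} {p = true  ∷ p} (there x∈p) = cong suc (1+∣p─⁅x⁆∣≡∣p∣ x∈p)
1+∣p─⁅x⁆∣≡∣p∣ {x = suc x} {p = false ∷ p} (there x∈p) = 1+∣p─⁅x⁆∣≡∣p∣ x∈p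

∣rename∣≡∣∣ : x ∈ p → y ∉ p → ∣ rename x y p ∣ ≡ ∣ p ∣
∣rename∣≡∣∣ {p = p} x∈p y∉p =
  trans (∣p∪⁅x⁆∣≡1+∣p∣ (y∉p ∘ p─q⊆p p _)) (1+∣p─⁅x⁆∣≡∣p∣ x∈p)

⊆∧∣∣≤⇒≡ : p ⊆ q → ∣ q ∣ ≤ ∣ p ∣ → p ≡ q
⊆∧∣∣≤⇒≡ {p = p} {q = q} p⊆q ∣q∣≤∣p∣ with q ⊆? p
... | yes q⊆p = ⊆-antisym p⊆q q⊆p
... | no  q⊈p = ⊥-elim (<⇒≱ (p⊂q⇒∣p∣<∣q∣ (p⊆q , ⊈⇒∃ q⊈p)) ∣q∣≤∣p∣)

χ : Bool → ℕ
χ true  = 1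
χ false = 0

χ-lookup-∈ : x ∈ p → χ (lookup p x) ≡ 1
χ-lookup-∈ = cong χ ∘ ∈⇒lookup

χ-lookup-∉ : x ∉ p → χ (lookup p x) ≡ 0
χ-lookup-∉ = cong χ ∘ ∉⇒lookup

χ-lookup-mono : p ⊆ q → ∀ x → χ (lookup p x) ≤ χ (lookup q x)
χ-lookup-mono {p = p} p⊆q x with lookup p x in px
... | true  = ≤-reflexive (sym (χ-lookup-∈ (p⊆q (lookup⇒∈ px))))
... | false = z≤n

χ≤1 : ∀ b → χ b ≤ 1
χ≤1 true  = ≤-refl
χ≤1 false = z≤n

∣∣-pointwise-≤ : ∀ (p q u v : Subset n) →
                 (∀ i → χ (lookup p i) + χ (lookup q i) ≤ χ (lookup u i) + χ (lookup v i)) →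
                 ∣ p ∣ + ∣ q ∣ ≤ ∣ u ∣ + ∣ v ∣
∣∣-pointwise-≤ [] [] [] [] _ = z≤n
∣∣-pointwise-≤ (a ∷ p) (b ∷ q) (c ∷ u) (d ∷ v) h = begin
  ∣ a ∷ p ∣ + ∣ b ∷ q ∣             ≡⟨ cong₂ _+_ (∣∷∣ a p) (∣∷∣ b q) ⟩
  (χ a + ∣ p ∣) + (χ b + ∣ q ∣)     ≡⟨ interchange (χ a) (∣ p ∣) (χ b) (∣ q ∣) ⟩
  (χ a + χ b) + (∣ p ∣ + ∣ q ∣)     ≤⟨ +-mono-≤ (h zero) (∣∣-pointwise-≤ p q u v (h ∘ suc)) ⟩
  (χ c + χ d) + (∣ u ∣ + ∣ v ∣)     ≡⟨ interchange (χ c) (χ d) (∣ u ∣) (∣ v ∣) ⟩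
  (χ c + ∣ u ∣) + (χ d + ∣ v ∣)     ≡⟨ cong₂ _+_ (∣∷∣ c u) (∣∷∣ d v) ⟨
  ∣ c ∷ u ∣ + ∣ d ∷ v ∣             ∎
  where
  open ≤-Reasoning
  ∣∷∣ : ∀ {n} s (p : Subset n) → ∣ s ∷ p ∣ ≡ χ s + ∣ p ∣
  ∣∷∣ true  p = refl
  ∣∷∣ false p = refl

∣∣-pointwise : ∀ (p q u v : Subset n) →
               (∀ i → χ (lookup p i) + χ (lookup q i) ≡ χ (lookup u i) + χ (lookup v i)) →
               ∣ p ∣ + ∣ q ∣ ≡ ∣ u ∣ + ∣ v ∣
∣∣-pointwise p q u v h = ≤-antisym (∣∣-pointwise-≤ p q u v (≤-reflexive ∘ h))
                                   (∣∣-pointwise-≤ u v p q (≤-reflexive ∘ sym ∘ h))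

∣p─q∣+∣q∣≡∣p∣ : ∀ (p q : Subset n) → q ⊆ p → ∣ p ─ q ∣ + ∣ q ∣ ≡ ∣ p ∣
∣p─q∣+∣q∣≡∣p∣ {n} p q q⊆p = begin
  ∣ p ─ q ∣ + ∣ q ∣  ≡⟨ ∣∣-pointwise (p ─ q) q p ⊥ pointwise ⟩
  ∣ p ∣ + ∣ ⊥ {n} ∣  ≡⟨ cong (λ k → ∣ p ∣ + k) (∣⊥∣≡0 n) ⟩
  ∣ p ∣ + 0          ≡⟨ +-identityʳ _ ⟩
  ∣ p ∣              ∎
  where
  open ≡-Reasoning
  pointwise : ∀ i → χ (lookup (p ─ q) i) + χ (lookup q i) ≡ χ (lookup p i) + χ (lookup ⊥ i)
  pointwise i rewrite lookup-─ p q i | lookup-⊥ i with lookup q i in qi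
  ... | true  rewrite ⊆⇒lookup q⊆p qi = refl
  ... | false rewrite ∧-identityʳ (lookup p i) = refl

∣p∪q∣+∣p∩q∣≡∣p∣+∣q∣ : ∀ (p q : Subset n) → ∣ p ∪ q ∣ + ∣ p ∩ q ∣ ≡ ∣ p ∣ + ∣ q ∣
∣p∪q∣+∣p∩q∣≡∣p∣+∣q∣ p q = ∣∣-pointwise (p ∪ q) (p ∩ q) p q pointwise
  where
  pointwise : ∀ i → χ (lookup (p ∪ q) i) + χ (lookup (p ∩ q) i) ≡ χ (lookup p i) + χ (lookup q i)
  pointwise i rewrite lookup-∪ p q i | lookup-∩ p q i with lookup p i | lookup q i
  ... | true  | true  = refl
  ... | true  | false = refl
  ... | false | true  = refl
  ... | false | false = refl

─-antitone-∣∣ : ∀ {p q q′ : Subset n} → q ⊆ p → q′ ⊆ p → ∣ q ∣ ≤ ∣ q′ ∣ → ∣ p ─ q′ ∣ ≤ ∣ p ─ q ∣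
─-antitone-∣∣ {p = p} {q} {q′} q⊆p q′⊆p ∣q∣≤∣q′∣ = +-cancelʳ-≤ ∣ q ∣ _ _ (begin
  ∣ p ─ q′ ∣ + ∣ q ∣   ≤⟨ +-monoʳ-≤ ∣ p ─ q′ ∣ ∣q∣≤∣q′∣ ⟩
  ∣ p ─ q′ ∣ + ∣ q′ ∣  ≡⟨ ∣p─q∣+∣q∣≡∣p∣ p q′ q′⊆p ⟩
  ∣ p ∣                ≡⟨ ∣p─q∣+∣q∣≡∣p∣ p q q⊆p ⟨
  ∣ p ─ q ∣ + ∣ q ∣    ∎)
  where open ≤-Reasoning

∧-elim : ∀ {a b} → T (a ∧ b) → T a × T b
∧-elim = Equivalence.to T-∧

∧-intro : ∀ {a b} → T a → T b → T (a ∧ b)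
∧-intro ta tb = Equivalence.from T-∧ (ta , tb)

T-not⁺ : ∀ {b} → ¬ T b → T (not b)
T-not⁺ {true}  ¬t = ¬t tt
T-not⁺ {false} _  = tt

T-not⁻ : ∀ {b} → T (not b) → ¬ T b
T-not⁻ {true} ()

⊆⇒subB : p ⊆ q → T (subB p q)
⊆⇒subB {p = []}        {q = []}        _   = tt
⊆⇒subB {p = true  ∷ p} {q = true  ∷ q} p⊆q = ⊆⇒subB (drop-∷-⊆ p⊆q)
⊆⇒subB {p = true  ∷ p} {q = false ∷ q} p⊆q with p⊆q here
... | ()
⊆⇒subB {p = false ∷ p} {q = _     ∷ q} p⊆q = ⊆⇒subB (drop-∷-⊆ p⊆q)

subB⇒⊆ : T (subB p q) → p ⊆ q
subB⇒⊆ {p = []}        {q = []}        _ ()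
subB⇒⊆ {p = true  ∷ p} {q = true  ∷ q} t = in⊆in (subB⇒⊆ t)
subB⇒⊆ {p = false ∷ p} {q = _     ∷ q} t = out⊆ (subB⇒⊆ t)

eqB⇒≡ : T (eqB p q) → p ≡ q
eqB⇒≡ t = ⊆-antisym (subB⇒⊆ (proj₁ (∧-elim t))) (subB⇒⊆ (proj₂ (∧-elim t)))

eqB-refl : ∀ (p : Subset n) → T (eqB p p)
eqB-refl p = ∧-intro {subB p p} (⊆⇒subB {p = p} ⊆-refl) (⊆⇒subB {p = p} ⊆-refl)

ssubB⁺ : p ⊆ q → ¬ (q ⊆ p) → T (ssubB p q)
ssubB⁺ p⊆q q⊈p = ∧-intro (⊆⇒subB p⊆q) (T-not⁺ (q⊈p ∘ subB⇒⊆))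

ssubB⇒⊂ : T (ssubB p q) → p ⊂ q
ssubB⇒⊂ t = subB⇒⊆ (proj₁ (∧-elim t)) , ⊈⇒∃ (T-not⁻ (proj₂ (∧-elim t)) ∘ ⊆⇒subB)

∈-allSubsets : ∀ (c : Subset n) → c ∈ˡ allSubsets n
∈-allSubsets []                    = hereˡ refl
∈-allSubsets {suc n} (true  ∷ c) = ∈-++⁺ˡ (∈-map⁺ (true ∷_) (∈-allSubsets c))
∈-allSubsets {suc n} (false ∷ c) = ∈-++⁺ʳ (map (true ∷_) (allSubsets n)) (∈-map⁺ (false ∷_) (∈-allSubsets c))

any-allSubsets⁺ : ∀ (f : Subset n → Bool) c → T (f c) → T (any f (allSubsets n))
any-allSubsets⁺ f c = any⁺ f ∘ lose (∈-allSubsets c)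

any-allSubsets⁻ : ∀ (f : Subset n → Bool) → T (any f (allSubsets n)) → ∃ λ c → T (f c)
any-allSubsets⁻ f = satisfied ∘ any⁻ f (allSubsets _)

imageOf⁺ : ∀ (F : Subset n → Bool) (f : Subset n → Subset n) {b} → T (F b) → T (imageOf F f (f b))
imageOf⁺ F f {b} Fb = any-allSubsets⁺ _ b (∧-intro Fb (eqB-refl (f b)))

image₂Of⁺ : ∀ (F G : Subset n → Bool) (g : Subset n → Subset n → Subset n) {b c} →
            T (F b) → T (G c) → T (image₂Of F G g (g b c))
image₂Of⁺ F G g {b} {c} Fb Gc =
  any-allSubsets⁺ _ b (any-allSubsets⁺ _ c (∧-intro Fb (∧-intro Gc (eqB-refl (g b c)))))

Maximal : (Subset n → Bool) → Subset n → Set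
Maximal F b = T (F b) × (∀ c → T (F c) → b ⊆ c → c ⊆ b)

Minimal : (Subset n → Bool) → Subset n → Set
Minimal F b = T (F b) × (∀ c → T (F c) → c ⊆ b → b ⊆ c)

-- Opaque, so that the witnesses extracted from these lemmas stay neutral terms: letting them unfold
-- makes checking the proofs that use them very slow.
opaque
  imageOf⁻ : ∀ (F : Subset n → Bool) (f : Subset n → Subset n) {c} →
             T (imageOf F f c) → ∃ λ b → T (F b) × f b ≡ c
  imageOf⁻ F f t with any-allSubsets⁻ _ t
  ... | b , t′ = b , proj₁ (∧-elim t′) , eqB⇒≡ (proj₂ (∧-elim {F b} t′))

  image₂Of⁻ : ∀ (F G : Subset n → Bool) (g : Subset n → Subset n → Subset n) {d} →
              T (image₂Of F G g d) → ∃₂ λ b c → T (F b) × T (G c) × g b c ≡ d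
  image₂Of⁻ F G g t with any-allSubsets⁻ _ t
  ... | b , t′ with any-allSubsets⁻ _ t′
  ...   | c , t″ with ∧-elim {F b} t″
  ...     | Fb , t‴ with ∧-elim {G c} t‴
  ...       | Gc , e = b , c , Fb , Gc , eqB⇒≡ e

  maximalIn⁻ : ∀ (F : Subset n → Bool) {b} → T (maximalIn F b) → Maximal F b
  maximalIn⁻ F {b} t = proj₁ (∧-elim t) , maximal
    where
    maximal : ∀ c → T (F c) → b ⊆ c → c ⊆ b
    maximal c Fc b⊆c with c ⊆? b
    ... | yes c⊆b = c⊆b
    ... | no  c⊈b = ⊥-elim (T-not⁻ (proj₂ (∧-elim {F b} t))
                      (any-allSubsets⁺ _ c (∧-intro Fc (ssubB⁺ b⊆c c⊈b))))

  minimalIn⁻ : ∀ (F : Subset n → Bool) {b} → T (minimalIn F b) → Minimal F b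
  minimalIn⁻ F {b} t = proj₁ (∧-elim t) , minimal
    where
    minimal : ∀ c → T (F c) → c ⊆ b → b ⊆ c
    minimal c Fc c⊆b with b ⊆? c
    ... | yes b⊆c = b⊆c
    ... | no  b⊈c = ⊥-elim (T-not⁻ (proj₂ (∧-elim {F b} t))
                      (any-allSubsets⁺ _ c (∧-intro Fc (ssubB⁺ c⊆b b⊈c))))

  maximalIn-above : ∀ (F : Subset n → Bool) {c} → T (F c) → ∃ λ d → T (maximalIn F d) × c ⊆ d
  maximalIn-above {n} F {c} = go c (⊃-wellFounded c)
    where
    go : ∀ c → Acc _⊃_ c → T (F c) → ∃ λ d → T (maximalIn F d) × c ⊆ d
    go c (acc rec) Fc with T? (any (λ e → F e ∧ ssubB c e) (allSubsets n))
    ... | no  none = c , ∧-intro Fc (T-not⁺ none) , ⊆-refl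
    ... | yes some with any-allSubsets⁻ _ some
    ...   | e , t with ∧-elim {F e} t
    ...     | Fe , c⊂e with go e (rec (ssubB⇒⊂ c⊂e)) Fe
    ...       | d , Md , e⊆d = d , Md , ⊆-trans (proj₁ (ssubB⇒⊂ c⊂e)) e⊆d

  minimalIn-below : ∀ (F : Subset n → Bool) {c} → T (F c) → ∃ λ d → T (minimalIn F d) × d ⊆ c
  minimalIn-below {n} F {c} = go c (⊂-wellFounded c)
    where
    go : ∀ c → Acc _⊂_ c → T (F c) → ∃ λ d → T (minimalIn F d) × d ⊆ c
    go c (acc rec) Fc with T? (any (λ e → F e ∧ ssubB e c) (allSubsets n))
    ... | no  none = c , ∧-intro Fc (T-not⁺ none) , ⊆-refl
    ... | yes some with any-allSubsets⁻ _ some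
    ...   | e , t with ∧-elim {F e} t
    ...     | Fe , e⊂c with go e (rec (ssubB⇒⊂ e⊂c)) Fe
    ...       | d , Md , d⊆e = d , Md , ⊆-trans d⊆e (proj₁ (ssubB⇒⊂ e⊂c))

-- rank M folds a step function local to Defs; unification names it.
private
  rank-as-fold : (M : SetSystem n) → Σ (Subset n → ℕ → ℕ) λ step → rank M ≡ foldr step 0 (allSubsets n)
  rank-as-fold M = _ , refl

  rank-step : (M : SetSystem n) → Subset n → ℕ → ℕ
  rank-step M = proj₁ (rank-as-fold M)

∣base∣≤rank : ∀ (M : SetSystem n) {b} → T (isBase M b) → ∣ b ∣ ≤ rank M
∣base∣≤rank {n} M {b} Bb = go (allSubsets n) (∈-allSubsets b)
  where
  go : ∀ xs → b ∈ˡ xs → ∣ b ∣ ≤ foldr (rank-step M) 0 xs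
  go (c ∷ xs) b∈ with isBase M c in eq
  go (c ∷ xs) (hereˡ refl) | true  = m≤m⊔n _ _
  go (c ∷ xs) (hereˡ refl) | false = ⊥-elim (subst T eq Bb)
  go (c ∷ xs) (thereˡ b∈)  | true  = ≤-trans (go xs b∈) (m≤n⊔m _ _)
  go (c ∷ xs) (thereˡ b∈)  | false = go xs b∈

opaque
  rank-attained : ∀ (M : SetSystem n) {b} → T (isBase M b) → ∃ λ b′ → T (isBase M b′) × rank M ≡ ∣ b′ ∣
  rank-attained {n} M {b} Bb with go (allSubsets n)
    where
    go : ∀ xs → foldr (rank-step M) 0 xs ≡ 0 ⊎ ∃ λ b′ → T (isBase M b′) × foldr (rank-step M) 0 xs ≡ ∣ b′ ∣
    go []       = inj₁ refl
    go (c ∷ xs) with isBase M c in eq | go xs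
    ... | false | r = r
    ... | true  | inj₁ r≡0 = inj₂ (c , subst T (sym eq) tt , trans (cong (∣ c ∣ ⊔_) r≡0) (⊔-identityʳ _))
    ... | true  | inj₂ (b′ , Bb′ , r≡) with ⊔-sel ∣ c ∣ (foldr (rank-step M) 0 xs)
    ...   | inj₁ ⊔≡c = inj₂ (c , subst T (sym eq) tt , ⊔≡c)
    ...   | inj₂ ⊔≡r = inj₂ (b′ , Bb′ , trans ⊔≡r r≡)
  ... | inj₂ attained = attained
  ... | inj₁ rank≡0   = b , Bb , trans rank≡0 (sym (n≤0⇒n≡0 (subst (∣ b ∣ ≤_) rank≡0 (∣base∣≤rank M Bb))))

∣∣≤rank-maximalIn : ∀ E (F : Subset n → Bool) {c} → T (F c) → ∣ c ∣ ≤ rank (mkSS E (maximalIn F))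
∣∣≤rank-maximalIn E F Fc with maximalIn-above F Fc
... | d , Md , c⊆d = ≤-trans (p⊆q⇒∣p∣≤∣q∣ c⊆d) (∣base∣≤rank (mkSS E (maximalIn F)) Md)

rank-maximalIn-attained : ∀ E (F : Subset n → Bool) {c} → T (F c) →
                          ∃ λ d → T (F d) × rank (mkSS E (maximalIn F)) ≡ ∣ d ∣
rank-maximalIn-attained E F Fc with rank-attained (mkSS E (maximalIn F)) (proj₁ (proj₂ (maximalIn-above F Fc)))
... | d , Md , rank≡ = d , proj₁ (maximalIn⁻ F Md) , rank≡

-- Independence matroids

record IndependenceMatroid (n : ℕ) : Set₁ where
  field
    Independent   : Subset n → Set
    independent-⊆ : ∀ {I J} → I ⊆ J → Independent J → Independent I
    augment       : ∀ {I J} → Independent I → Independent J → ∣ I ∣ < ∣ J ∣ →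
                    ∃ λ x → x ∈ J × x ∉ I × Independent (I ∪ ⁅ x ⁆)

  MaximalIndependentIn : Subset n → Subset n → Set
  MaximalIndependentIn A Z = Independent Z × Z ⊆ A × (∀ {Y} → Independent Y → Y ⊆ A → Z ⊆ Y → Y ⊆ Z)

  maximal-independent-is-largest : ∀ {A Z Y} → MaximalIndependentIn A Z →
                                   Independent Y → Y ⊆ A → ∣ Y ∣ ≤ ∣ Z ∣
  maximal-independent-is-largest {A} {Z} {Y} (iZ , Z⊆A , maximal) iY Y⊆A with ∣ Y ∣ ≤? ∣ Z ∣
  ... | yes ∣Y∣≤∣Z∣ = ∣Y∣≤∣Z∣
  ... | no  ∣Y∣≰∣Z∣ with augment iZ iY (≰⇒> ∣Y∣≰∣Z∣)
  ...   | x , x∈Y , x∉Z , iZ+x =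
    ⊥-elim (x∉Z (maximal iZ+x (∪-⊆ Z⊆A (⁅x⁆⊆ (Y⊆A x∈Y))) (p⊆p∪q _) (x∈p∪⁅x⁆ Z x)))

withIndependence : (M : IndependenceMatroid n) (P : Subset n → Set) →
                   (∀ {I} → P I → IndependenceMatroid.Independent M I) →
                   (∀ {I} → IndependenceMatroid.Independent M I → P I) → IndependenceMatroid n
withIndependence M P to from = record
  { Independent   = P
  ; independent-⊆ = λ I⊆J → from ∘ independent-⊆ I⊆J ∘ to
  ; augment       = λ pI pJ ∣I∣<∣J∣ →
      let x , x∈J , x∉I , iI+x = augment (to pI) (to pJ) ∣I∣<∣J∣ in x , x∈J , x∉I , from iI+x
  }
  where open IndependenceMatroid M

-- Matroids given by their bases, and duality

dual-base⁻ : ∀ (M : SetSystem n) {c} → T (isBase (dual M) c) → c ⊆ ground M × T (isBase M (ground M ─ c))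
dual-base⁻ M t = subB⇒⊆ (proj₁ (∧-elim t)) , proj₂ (∧-elim t)

dual-base⁺ : ∀ (M : SetSystem n) {c} → c ⊆ ground M → T (isBase M (ground M ─ c)) → T (isBase (dual M) c)
dual-base⁺ M c⊆E Bc = ∧-intro (⊆⇒subB c⊆E) Bc

module BaseMatroid {n} (M : SetSystem n) (isMatroid : IsMatroid M) where
  open IsMatroid isMatroid

  Base : Subset n → Set
  Base b = T (isBase M b)

  ∣base∣≡∣base∣ : ∀ {b₁ b₂} → Base b₁ → Base b₂ → ∣ b₁ ∣ ≡ ∣ b₂ ∣
  ∣base∣≡∣base∣ {b₁} {b₂} Bb₁ Bb₂ = go b₁ (⊂-wellFounded (b₁ ─ b₂)) Bb₁
    where
    go : ∀ b → Acc _⊂_ (b ─ b₂) → Base b → ∣ b ∣ ≡ ∣ b₂ ∣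
    go b (acc rec) Bb with b ⊆? b₂
    ... | yes b⊆b₂ = cong ∣_∣ (⊆-antisym b⊆b₂ (decidable-stable (b₂ ⊆? b) b₂⊆b))
      where
      b₂⊆b : ¬ ¬ (b₂ ⊆ b)
      b₂⊆b b₂⊈b with ⊈⇒∃ b₂⊈b
      ... | x , x∈b₂ , x∉b with exchange _ _ Bb₂ Bb x x∈b₂ x∉b
      ...   | y , y∈b , y∉b₂ , _ = y∉b₂ (b⊆b₂ y∈b)
    ... | no b⊈b₂ with ⊈⇒∃ b⊈b₂
    ...   | x , x∈b , x∉b₂ with exchange _ _ Bb Bb₂ x x∈b x∉b₂
    ...     | y , y∈b₂ , y∉b , Bb′ =
      trans (sym (∣rename∣≡∣∣ x∈b y∉b)) (go _ (rec (rename-─⊂ x∈b x∉b₂ y∈b₂)) Bb′)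

  Independent : Subset n → Set
  Independent I = ∃ λ b → Base b × I ⊆ b

  augment : ∀ {I J} → Independent I → Independent J → ∣ I ∣ < ∣ J ∣ →
            ∃ λ x → x ∈ J × x ∉ I × Independent (I ∪ ⁅ x ⁆)
  augment {I} {J} (b₁ , Bb₁ , I⊆b₁) (b₂ , Bb₂ , J⊆b₂) ∣I∣<∣J∣ = go b₁ (⊂-wellFounded (b₁ ─ b₂)) Bb₁ I⊆b₁
    where
    -- Exchange elements of b ∖ (I ∪ b₂) for elements of b₂ until b meets J ∖ I; if that never
    -- happens, counting contradicts ∣ I ∣ < ∣ J ∣.
    go : ∀ b → Acc _⊂_ (b ─ b₂) → Base b → I ⊆ b → ∃ λ x → x ∈ J × x ∉ I × Independent (I ∪ ⁅ x ⁆)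
    go b (acc rec) Bb I⊆b with any? (λ x → x ∈? J ×-dec ¬? (x ∈? I) ×-dec x ∈? b)
    ... | yes (x , x∈J , x∉I , x∈b) = x , x∈J , x∉I , b , Bb , ∪-⊆ I⊆b (⁅x⁆⊆ x∈b)
    ... | no  J∖I∖b≡∅ with any? (λ x → x ∈? b ×-dec ¬? (x ∈? I) ×-dec ¬? (x ∈? b₂))
    ...   | yes (x , x∈b , x∉I , x∉b₂) with exchange _ _ Bb Bb₂ x x∈b x∉b₂
    ...     | y , y∈b₂ , _ , Bb′ =
      go _ (rec (rename-─⊂ x∈b x∉b₂ y∈b₂)) Bb′ (⊆-trans (⊆-─⁅x⁆ I⊆b x∉I) (p⊆p∪q _))
    go b (acc rec) Bb I⊆b | no J∖I∖b≡∅ | no b∖I∖b₂≡∅ = ⊥-elim (<⇒≱ ∣I∣<∣J∣ ∣J∣≤∣I∣)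
      where
      pointwise : ∀ i → χ (lookup b i) + χ (lookup J i) ≤ χ (lookup I i) + χ (lookup b₂ i)
      pointwise i with i ∈? I | i ∈? b
      ... | yes i∈I | _ rewrite χ-lookup-∈ i∈I =
        +-mono-≤ (χ≤1 (lookup b i)) (χ-lookup-mono J⊆b₂ i)
      ... | no i∉I | yes i∈b
        rewrite χ-lookup-∈ i∈b | χ-lookup-∉ i∉I
              | χ-lookup-∈ (decidable-stable (i ∈? b₂) (λ i∉b₂ → b∖I∖b₂≡∅ (i , i∈b , i∉I , i∉b₂)))
              | χ-lookup-∉ (λ i∈J → J∖I∖b≡∅ (i , i∈J , i∉I , i∈b)) = ≤-refl
      ... | no i∉I | no i∉b rewrite χ-lookup-∉ i∉b | χ-lookup-∉ i∉I = χ-lookup-mono J⊆b₂ i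
      ∣J∣≤∣I∣ : ∣ J ∣ ≤ ∣ I ∣
      ∣J∣≤∣I∣ = +-cancelˡ-≤ ∣ b ∣ _ _ (begin
        ∣ b ∣ + ∣ J ∣   ≤⟨ ∣∣-pointwise-≤ b J I b₂ pointwise ⟩
        ∣ I ∣ + ∣ b₂ ∣  ≡⟨ +-comm ∣ I ∣ ∣ b₂ ∣ ⟩
        ∣ b₂ ∣ + ∣ I ∣  ≡⟨ cong (_+ ∣ I ∣) (∣base∣≡∣base∣ Bb₂ Bb) ⟩
        ∣ b ∣ + ∣ I ∣   ∎)
        where open ≤-Reasoning

  independenceMatroid : IndependenceMatroid n
  independenceMatroid = record
    { Independent   = Independent
    ; independent-⊆ = λ I⊆J (b , Bb , J⊆b) → b , Bb , ⊆-trans I⊆J J⊆b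
    ; augment       = augment
    }

  extend : ∀ {I J} → Independent I → Independent J →
           ∃ λ K → Independent K × I ⊆ K × K ⊆ I ∪ J × ∣ J ∣ ≤ ∣ K ∣
  extend {I} {J} iI iJ = go I (⊃-wellFounded I) iI ⊆-refl (p⊆p∪q J)
    where
    go : ∀ K → Acc _⊃_ K → Independent K → I ⊆ K → K ⊆ I ∪ J →
         ∃ λ K → Independent K × I ⊆ K × K ⊆ I ∪ J × ∣ J ∣ ≤ ∣ K ∣
    go K (acc rec) iK I⊆K K⊆I∪J with ∣ J ∣ ≤? ∣ K ∣
    ... | yes ∣J∣≤∣K∣ = K , iK , I⊆K , K⊆I∪J , ∣J∣≤∣K∣
    ... | no  ∣J∣≰∣K∣ with augment iK iJ (≰⇒> ∣J∣≰∣K∣)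
    ...   | x , x∈J , x∉K , iK+x =
      go (K ∪ ⁅ x ⁆) (rec (p⊂p∪⁅x⁆ x∉K)) iK+x (⊆-trans I⊆K (p⊆p∪q _)) (∪-⊆ K⊆I∪J (⁅x⁆⊆ (q⊆p∪q I J x∈J)))

  full-independent⇒base : ∀ {K b} → Independent K → Base b → ∣ b ∣ ≤ ∣ K ∣ → Base K
  full-independent⇒base (b′ , Bb′ , K⊆b′) Bb ∣b∣≤∣K∣ =
    subst Base (sym (⊆∧∣∣≤⇒≡ K⊆b′ (≤-trans (≤-reflexive (∣base∣≡∣base∣ Bb′ Bb)) ∣b∣≤∣K∣))) Bb′

  dual-exchange : ∀ {b₁ b₂ x} → Base b₁ → Base b₂ → x ∈ b₂ → x ∉ b₁ →
                  ∃ λ y → y ∈ b₁ × y ∉ b₂ × Base (rename y x b₁)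
  dual-exchange {b₁} {b₂} {x} Bb₁ Bb₂ x∈b₂ x∉b₁
    with extend {(b₁ ∩ b₂) ∪ ⁅ x ⁆} (b₂ , Bb₂ , ∪-⊆ (p∩q⊆q b₁ b₂) (⁅x⁆⊆ x∈b₂)) (b₁ , Bb₁ , ⊆-refl)
  ... | K , iK , I⊆K , K⊆I∪b₁ , ∣b₁∣≤∣K∣ with ⊈⇒∃ b₁+x⊈K
    where
    b₁+x⊈K : ¬ (b₁ ∪ ⁅ x ⁆ ⊆ K)
    b₁+x⊈K b₁+x⊆K = <⇒≱ (≤-trans (≤-reflexive (sym (∣p∪⁅x⁆∣≡1+∣p∣ x∉b₁))) (p⊆q⇒∣p∣≤∣q∣ b₁+x⊆K))
                        (≤-reflexive (∣base∣≡∣base∣ (full-independent⇒base iK Bb₁ ∣b₁∣≤∣K∣) Bb₁))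
  ... | y , y∈b₁+x , y∉K = y , y∈b₁ , y∉b₂ , subst Base K≡b₁-y+x (full-independent⇒base iK Bb₁ ∣b₁∣≤∣K∣)
    where
    y∈b₁ : y ∈ b₁
    y∈b₁ with x∈p∪q⁻ b₁ ⁅ x ⁆ y∈b₁+x
    ... | inj₁ y∈b₁  = y∈b₁
    ... | inj₂ y∈⁅x⁆ rewrite x∈⁅y⁆⇒x≡y x y∈⁅x⁆ = ⊥-elim (y∉K (I⊆K (x∈p∪⁅x⁆ (b₁ ∩ b₂) x)))
    y∉b₂ : y ∉ b₂
    y∉b₂ y∈b₂ = y∉K (I⊆K (p⊆p∪q ⁅ x ⁆ (x∈p∩q⁺ (y∈b₁ , y∈b₂))))
    K⊆b₁-y+x : K ⊆ rename y x b₁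
    K⊆b₁-y+x {z} z∈K with x∈p∪q⁻ (b₁ ∩ b₂ ∪ ⁅ x ⁆) b₁ (K⊆I∪b₁ z∈K)
    ... | inj₂ z∈b₁ = p⊆p∪q ⁅ x ⁆ (x∈p∧x≢y⇒x∈p-y z∈b₁ λ { refl → y∉K z∈K })
    ... | inj₁ z∈I with x∈p∪q⁻ (b₁ ∩ b₂) ⁅ x ⁆ z∈I
    ...   | inj₁ z∈b₁∩b₂ = p⊆p∪q ⁅ x ⁆ (x∈p∧x≢y⇒x∈p-y (p∩q⊆p b₁ b₂ z∈b₁∩b₂) λ { refl → y∉K z∈K })
    ...   | inj₂ z∈⁅x⁆   = q⊆p∪q _ ⁅ x ⁆ z∈⁅x⁆
    K≡b₁-y+x : K ≡ rename y x b₁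
    K≡b₁-y+x = ⊆∧∣∣≤⇒≡ K⊆b₁-y+x (≤-trans (≤-reflexive (∣rename∣≡∣∣ y∈b₁ x∉b₁)) ∣b₁∣≤∣K∣)

dual-base-of : ∀ (M : SetSystem n) → IsMatroid M → ∀ {a} → T (isBase M a) → T (isBase (dual M) (ground M ─ a))
dual-base-of M isMatroid {a} Ba = dual-base⁺ M (p─q⊆p (ground M) a)
  (subst (T ∘ isBase M) (sym (p─[p─q]≡q (ground M) a (IsMatroid.bases-in-ground isMatroid a Ba))) Ba)

dual-base-is : ∀ (M : SetSystem n) {b} → T (isBase (dual M) b) → ∃ λ a → T (isBase M a) × b ≡ ground M ─ a
dual-base-is M {b} Db = let b⊆E , Ba = dual-base⁻ M Db in _ , Ba , sym (p─[p─q]≡q (ground M) b b⊆E)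

dual-isMatroid : (M : SetSystem n) → IsMatroid M → IsMatroid (dual M)
dual-isMatroid M isMatroid = record
  { bases-in-ground = λ c → proj₁ ∘ dual-base⁻ M
  ; base-exists     = E ─ b₀ , dual-base-of M isMatroid Bb₀
  ; exchange        = dual-exchange′
  }
  where
  open IsMatroid isMatroid
  open BaseMatroid M isMatroid using (dual-exchange)
  E = ground M
  b₀ = proj₁ base-exists
  Bb₀ = proj₂ base-exists
  dual-exchange′ : ∀ c₁ c₂ → T (isBase (dual M) c₁) → T (isBase (dual M) c₂) → ∀ x → x ∈ c₁ → x ∉ c₂ →
                   ∃ λ y → y ∈ c₂ × y ∉ c₁ × T (isBase (dual M) ((c₁ ─ ⁅ x ⁆) ∪ ⁅ y ⁆))
  dual-exchange′ c₁ c₂ Dc₁ Dc₂ x x∈c₁ x∉c₂ =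
    complement (dual-exchange Bb₁ Bb₂ (x∈p∧x∉q⇒x∈p─q (c₁⊆E x∈c₁) x∉c₂) (λ x∈E─c₁ → proj₂ (x∈p─q⁻ x∈E─c₁) x∈c₁))
    where
    c₁⊆E = proj₁ (dual-base⁻ M Dc₁)
    Bb₁  = proj₂ (dual-base⁻ M Dc₁)
    Bb₂  = proj₂ (dual-base⁻ M Dc₂)
    complement : (∃ λ y → y ∈ E ─ c₁ × y ∉ E ─ c₂ × T (isBase M (rename y x (E ─ c₁)))) →
                 ∃ λ y → y ∈ c₂ × y ∉ c₁ × T (isBase (dual M) (rename x y c₁))
    complement (y , y∈E─c₁ , y∉E─c₂ , B′) =
      y , y∈c₂ , y∉c₁ ,
      dual-base⁺ M (∪-⊆ (⊆-trans (p─q⊆p c₁ _) c₁⊆E) (⁅x⁆⊆ y∈E))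
        (subst (T ∘ isBase M) (sym (─-rename E c₁ (c₁⊆E x∈c₁) x≢y)) B′)
      where
      y∈E : y ∈ E
      y∈E = proj₁ (x∈p─q⁻ y∈E─c₁)
      y∉c₁ : y ∉ c₁
      y∉c₁ = proj₂ (x∈p─q⁻ y∈E─c₁)
      y∈c₂ : y ∈ c₂
      y∈c₂ = decidable-stable (y ∈? c₂) (y∉E─c₂ ∘ x∈p∧x∉q⇒x∈p─q y∈E)
      x≢y : x ≢ y
      x≢y refl = y∉c₁ x∈c₁

-- Identifying two elements

-- The independent sets are the injective images of independent sets of M under y ↦ x.
module Identify {n} (M : IndependenceMatroid n) (x y : Fin n) (x≢y : x ≢ y) where
  open IndependenceMatroid M

  -- J is I, possibly with x replaced by y; then y ↦ x maps J injectively onto I.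
  record Renames (I J : Subset n) : Set where
    field
      y∉I       : lookup I y ≡ false
      elsewhere : ∀ {i} → i ≢ x → i ≢ y → lookup J i ≡ lookup I i
      x-or-y    : (lookup J x ∨ lookup J y) ≡ lookup I x
      not-both  : (lookup J x ∧ lookup J y) ≡ false
  open Renames

  Independent′ : Subset n → Set
  Independent′ I = ∃ λ J → Independent J × Renames I J

  y≢x : y ≢ x
  y≢x = x≢y ∘ sym

  renames-cases : ∀ {I J} → Renames I J → J ≡ I ⊎ (J ≡ rename x y I × lookup I x ≡ true)
  renames-cases {I} {J} r with lookup J y in Jy
  ... | false = inj₁ (lookup-ext pointwise)
    where
    pointwise : ∀ i → lookup J i ≡ lookup I i
    pointwise i with i ≟ x | i ≟ y
    ... | yes refl | _        = trans (sym (∨-identityʳ _)) (trans (cong (lookup J x ∨_) (sym Jy)) (x-or-y r))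
    ... | no  _    | yes refl = trans Jy (sym (y∉I r))
    ... | no  i≢x  | no  i≢y  = elsewhere r i≢x i≢y
  ... | true = inj₂ (lookup-ext pointwise , trans (sym (x-or-y r)) (trans (cong (lookup J x ∨_) Jy) (∨-zeroʳ _)))
    where
    pointwise : ∀ i → lookup J i ≡ lookup (rename x y I) i
    pointwise i with i ≟ x | i ≟ y
    ... | yes refl | _        = trans (sym (∧-identityʳ _)) (trans (cong (lookup J x ∧_) (sym Jy))
                                    (trans (not-both r) (sym (lookup-rename-source I x≢y))))
    ... | no  _    | yes refl = trans Jy (sym (lookup-rename-target I))
    ... | no  i≢x  | no  i≢y  = trans (elsewhere r i≢x i≢y) (sym (lookup-rename-other I i≢x i≢y))

  renames-size : ∀ {I J} → Renames I J → ∣ J ∣ ≡ ∣ I ∣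
  renames-size {I} r with renames-cases r
  ... | inj₁ refl        = refl
  ... | inj₂ (refl , Ix) = ∣rename∣≡∣∣ {p = I} (lookup⇒∈ Ix) (lookup⇒∉ (y∉I r))

  renames-refl : ∀ {I} → lookup I y ≡ false → Renames I I
  renames-refl {I} Iy = record
    { y∉I       = Iy
    ; elsewhere = λ _ _ → refl
    ; x-or-y    = trans (cong (lookup I x ∨_) Iy) (∨-identityʳ _)
    ; not-both  = trans (cong (lookup I x ∧_) Iy) (∧-zeroʳ _)
    }

  renames-rename : ∀ {I} → lookup I y ≡ false → lookup I x ≡ true → Renames I (rename x y I)
  renames-rename {I} Iy Ix = record
    { y∉I       = Iy
    ; elsewhere = lookup-rename-other I
    ; x-or-y    = trans (cong₂ _∨_ (lookup-rename-source I x≢y) (lookup-rename-target I)) (sym Ix)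
    ; not-both  = cong₂ _∧_ (lookup-rename-source I x≢y) (lookup-rename-target I)
    }

  renames-∪⁅⁆ : ∀ {I J z} → z ≢ x → z ≢ y → Renames I J → Renames (I ∪ ⁅ z ⁆) (J ∪ ⁅ z ⁆)
  renames-∪⁅⁆ {I} {J} {z} z≢x z≢y r = record
    { y∉I       = trans (lookup-∪ I ⁅ z ⁆ y) (cong₂ _∨_ (y∉I r) (⁅z⁆-off y≢z))
    ; elsewhere = λ {i} i≢x i≢y → trans (lookup-∪ J ⁅ z ⁆ i)
                    (trans (cong (_∨ lookup ⁅ z ⁆ i) (elsewhere r i≢x i≢y)) (sym (lookup-∪ I ⁅ z ⁆ i)))
    ; x-or-y    = begin
        lookup (J ∪ ⁅ z ⁆) x ∨ lookup (J ∪ ⁅ z ⁆) y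
          ≡⟨ cong₂ _∨_ (off-z J x≢z) (off-z J y≢z) ⟩
        lookup J x ∨ lookup J y  ≡⟨ x-or-y r ⟩
        lookup I x               ≡⟨ off-z I x≢z ⟨
        lookup (I ∪ ⁅ z ⁆) x     ∎
    ; not-both  = trans (cong₂ _∧_ (off-z J x≢z) (off-z J y≢z)) (not-both r)
    }
    where
    open ≡-Reasoning
    x≢z : x ≢ z
    x≢z = z≢x ∘ sym
    y≢z : y ≢ z
    y≢z = z≢y ∘ sym
    ⁅z⁆-off : ∀ {i} → i ≢ z → lookup ⁅ z ⁆ i ≡ false
    ⁅z⁆-off = ∉⇒lookup ∘ x≢y⇒x∉⁅y⁆
    off-z : ∀ K {i} → i ≢ z → lookup (K ∪ ⁅ z ⁆) i ≡ lookup K i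
    off-z K {i} i≢z = trans (lookup-∪ K ⁅ z ⁆ i) (trans (cong (lookup K i ∨_) (⁅z⁆-off i≢z)) (∨-identityʳ _))

  ∈-elsewhere : ∀ {I J i} → Renames I J → i ≢ x → i ≢ y → i ∈ J → i ∈ I
  ∈-elsewhere r i≢x i≢y i∈J = lookup⇒∈ (trans (sym (elsewhere r i≢x i≢y)) (∈⇒lookup i∈J))

  ∉-elsewhere : ∀ {I J i} → Renames I J → i ≢ x → i ≢ y → i ∉ J → i ∉ I
  ∉-elsewhere r i≢x i≢y i∉J = lookup⇒∉ (trans (sym (elsewhere r i≢x i≢y)) (∉⇒lookup i∉J))

  x∈source : ∀ {I J} → Renames I J → x ∈ J ⊎ y ∈ J → x ∈ I
  x∈source {J = J} r (inj₁ x∈J) = lookup⇒∈ (trans (sym (x-or-y r)) (cong (_∨ lookup J y) (∈⇒lookup x∈J)))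
  x∈source {J = J} r (inj₂ y∈J) =
    lookup⇒∈ (trans (sym (x-or-y r)) (trans (cong (lookup J x ∨_) (∈⇒lookup y∈J)) (∨-zeroʳ _)))

  ¬x∈∧y∈ : ∀ {I J} → Renames I J → x ∈ J → y ∈ J → ⊥₀
  ¬x∈∧y∈ r x∈J y∈J with trans (sym (cong₂ _∧_ (∈⇒lookup x∈J) (∈⇒lookup y∈J))) (not-both r)
  ... | ()

  independent′-⊆ : ∀ {I K} → I ⊆ K → Independent′ K → Independent′ I
  independent′-⊆ {I} {K} I⊆K (K′ , iK′ , r) = from (renames-cases r) (x ∈? I)
    where
    I∌y : lookup I y ≡ false
    I∌y = ∉⇒lookup (lookup⇒∉ (Renames.y∉I r) ∘ I⊆K)
    from : (K′ ≡ K ⊎ (K′ ≡ rename x y K × lookup K x ≡ true)) → Dec (x ∈ I) → Independent′ I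
    from (inj₁ refl)       _         = I , independent-⊆ I⊆K iK′ , renames-refl I∌y
    from (inj₂ (refl , _)) (yes x∈I) =
      rename x y I , independent-⊆ (∪-mono (─-mono I⊆K) ⊆-refl) iK′ , renames-rename I∌y (∈⇒lookup x∈I)
    from (inj₂ (refl , _)) (no  x∉I) =
      I , independent-⊆ (⊆-trans (⊆-─⁅x⁆ I⊆K x∉I) (p⊆p∪q _)) iK′ , renames-refl I∌y

  private
    Augmentation : Subset n → Subset n → Set
    Augmentation I K = ∃ λ g → g ∈ K × g ∉ I × Independent′ (I ∪ ⁅ g ⁆)

  lift-augmentation : ∀ {I K I′ K′ g} → Renames I I′ → Renames K K′ → g ≢ x → g ≢ y →
                      g ∈ K′ → g ∉ I′ → Independent (I′ ∪ ⁅ g ⁆) → Augmentation I K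
  lift-augmentation rI rK g≢x g≢y g∈K′ g∉I′ iI′+g =
    _ , ∈-elsewhere rK g≢x g≢y g∈K′ , ∉-elsewhere rI g≢x g≢y g∉I′ , _ , iI′+g , renames-∪⁅⁆ g≢x g≢y rI

  -- Since I″ already contains e and K′ contains at most one of x and y, the element added to I″
  -- avoids both, so the augmentation lifts to I.
  augment-containing : ∀ {I K I″ K′ e} → Independent I″ → Renames I I″ → Independent K′ → Renames K K′ →
                       e ≡ x ⊎ e ≡ y → e ∈ I″ → e ∈ K′ → ∣ I ∣ < ∣ K ∣ → Augmentation I K
  augment-containing iI″ rI″ iK′ rK e∈xy e∈I″ e∈K′ ∣I∣<∣K∣
    with augment iI″ iK′ (subst₂ _<_ (sym (renames-size rI″)) (sym (renames-size rK)) ∣I∣<∣K∣)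
  ... | g , g∈K′ , g∉I″ , iI″+g = lift-augmentation rI″ rK g≢x g≢y g∈K′ g∉I″ iI″+g
    where
    g≢x : g ≢ x
    g≢x refl = [ (λ { refl → g∉I″ e∈I″ }) , (λ { refl → ¬x∈∧y∈ rK g∈K′ e∈K′ }) ]′ e∈xy
    g≢y : g ≢ y
    g≢y refl = [ (λ { refl → ¬x∈∧y∈ rK e∈K′ g∈K′ }) , (λ { refl → g∉I″ e∈I″ }) ]′ e∈xy

  augment-through-pair : ∀ {I K I′ K′ e} → Renames I I′ → Independent K′ → Renames K K′ →
                         e ≡ x ⊎ e ≡ y → e ∈ K′ → e ∉ I′ → Independent (I′ ∪ ⁅ e ⁆) →
                         ∣ I ∣ < ∣ K ∣ → Augmentation I K
  augment-through-pair {I} {K} {I′} {K′} {e} rI iK′ rK e∈xy e∈K′ e∉I′ iI′+e ∣I∣<∣K∣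
    with x ∈? I | renames-cases rI
  ... | no x∉I | inj₂ (_ , Ix) = ⊥-elim (x∉I (lookup⇒∈ Ix))
  ... | no x∉I | inj₁ refl = x , x∈source rK x-or-y∈K′ , x∉I , add-x e∈xy
    where
    x-or-y∈K′ : x ∈ K′ ⊎ y ∈ K′
    x-or-y∈K′ = map-⊎ (λ e≡x → subst (_∈ K′) e≡x e∈K′) (λ e≡y → subst (_∈ K′) e≡y e∈K′) e∈xy
    y∉I+x : lookup (I ∪ ⁅ x ⁆) y ≡ false
    y∉I+x = ∉⇒lookup λ y∈ → [ lookup⇒∉ (Renames.y∉I rI) , y≢x ∘ x∈⁅y⁆⇒x≡y x ]′ (x∈p∪q⁻ I ⁅ x ⁆ y∈)
    add-x : e ≡ x ⊎ e ≡ y → Independent′ (I ∪ ⁅ x ⁆)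
    add-x (inj₁ refl) = I ∪ ⁅ x ⁆ , iI′+e , renames-refl y∉I+x
    add-x (inj₂ refl) = rename x y (I ∪ ⁅ x ⁆) , independent-⊆ (rename-∪⁅⁆⊆ I) iI′+e ,
                        renames-rename y∉I+x (∈⇒lookup (x∈p∪⁅x⁆ I x))
  ... | yes x∈I | inj₁ refl with e∈xy
  ...   | inj₁ refl = ⊥-elim (e∉I′ x∈I)
  ...   | inj₂ refl = augment-containing (independent-⊆ (rename⊆∪⁅⁆ I) iI′+e)
                        (renames-rename (Renames.y∉I rI) (∈⇒lookup x∈I)) iK′ rK e∈xy
                        (lookup⇒∈ (lookup-rename-target I)) e∈K′ ∣I∣<∣K∣
  augment-through-pair {I} rI iK′ rK e∈xy e∈K′ e∉I′ iI′+e ∣I∣<∣K∣ | yes x∈I | inj₂ (refl , _) with e∈xy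
  ...   | inj₂ refl = ⊥-elim (e∉I′ (lookup⇒∈ (lookup-rename-target I)))
  ...   | inj₁ refl = augment-containing (independent-⊆ (⊆rename∪⁅⁆ I) iI′+e)
                        (renames-refl (Renames.y∉I rI)) iK′ rK e∈xy x∈I e∈K′ ∣I∣<∣K∣

  augment′ : ∀ {I K} → Independent′ I → Independent′ K → ∣ I ∣ < ∣ K ∣ → Augmentation I K
  augment′ (I′ , iI′ , rI) (K′ , iK′ , rK) ∣I∣<∣K∣
    with augment iI′ iK′ (subst₂ _<_ (sym (renames-size rI)) (sym (renames-size rK)) ∣I∣<∣K∣)
  ... | e , e∈K′ , e∉I′ , iI′+e with e ≟ x | e ≟ y
  ...   | yes e≡x | _       = augment-through-pair rI iK′ rK (inj₁ e≡x) e∈K′ e∉I′ iI′+e ∣I∣<∣K∣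
  ...   | no  _   | yes e≡y = augment-through-pair rI iK′ rK (inj₂ e≡y) e∈K′ e∉I′ iI′+e ∣I∣<∣K∣
  ...   | no  e≢x | no  e≢y = lift-augmentation rI rK e≢x e≢y e∈K′ e∉I′ iI′+e

  identifiedMatroid : IndependenceMatroid n
  identifiedMatroid = record { Independent = Independent′ ; independent-⊆ = independent′-⊆ ; augment = augment′ }

-- Direct sums and unions

data ↑-View (m n : ℕ) : Fin (m + n) → Set where
  left  : ∀ j → ↑-View m n (j ↑ˡ n)
  right : ∀ k → ↑-View m n (m ↑ʳ k)

↑-view : ∀ m {n} (i : Fin (m + n)) → ↑-View m n i
↑-view zero    i       = right i
↑-view (suc m) zero    = left zero
↑-view (suc m) (suc i) with ↑-view m i
... | left  j = left (suc j)
... | right k = right k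

↑ˡ≢↑ʳ : ∀ {m n} (j : Fin m) (k : Fin n) → j ↑ˡ n ≢ m ↑ʳ k
↑ˡ≢↑ʳ {m} {n} j k eq with trans (sym (splitAt-↑ˡ m j n)) (trans (cong (splitAt m) eq) (splitAt-↑ʳ m n k))
... | ()

∣++∣ : ∀ {m n} (Z : Subset m) (Y : Subset n) → ∣ Z ++ Y ∣ ≡ ∣ Z ∣ + ∣ Y ∣
∣++∣ []          Y = refl
∣++∣ (true  ∷ Z) Y = cong suc (∣++∣ Z Y)
∣++∣ (false ∷ Z) Y = ∣++∣ Z Y

⊥++⊥ : ∀ {m n} → ⊥ {m} ++ ⊥ {n} ≡ ⊥
⊥++⊥ {zero}  = refl
⊥++⊥ {suc m} = cong (false ∷_) (⊥++⊥ {m})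

module _ {m n : ℕ} where

  ++-ext : ∀ {V W : Subset (m + n)} → (∀ j → lookup V (j ↑ˡ n) ≡ lookup W (j ↑ˡ n)) →
           (∀ k → lookup V (m ↑ʳ k) ≡ lookup W (m ↑ʳ k)) → V ≡ W
  ++-ext {V} {W} onLeft onRight = lookup-ext pointwise
    where
    pointwise : ∀ i → lookup V i ≡ lookup W i
    pointwise i with ↑-view m i
    ... | left  j = onLeft j
    ... | right k = onRight k

  ∪-++ : ∀ (A₁ B₁ : Subset m) (A₂ B₂ : Subset n) → (A₁ ++ A₂) ∪ (B₁ ++ B₂) ≡ (A₁ ∪ B₁) ++ (A₂ ∪ B₂)
  ∪-++ A₁ B₁ A₂ B₂ = zipWith-++ _∨_ A₁ A₂ B₁ B₂

  ++-∪⁅↑ˡ⁆ : ∀ (Z : Subset m) (Y : Subset n) j → (Z ++ Y) ∪ ⁅ j ↑ˡ n ⁆ ≡ (Z ∪ ⁅ j ⁆) ++ Y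
  ++-∪⁅↑ˡ⁆ Z Y j = begin
    (Z ++ Y) ∪ ⁅ j ↑ˡ n ⁆    ≡⟨ cong ((Z ++ Y) ∪_) (⁅↑ˡ⁆ j) ⟩
    (Z ++ Y) ∪ (⁅ j ⁆ ++ ⊥)  ≡⟨ ∪-++ Z ⁅ j ⁆ Y ⊥ ⟩
    (Z ∪ ⁅ j ⁆) ++ (Y ∪ ⊥)   ≡⟨ cong ((Z ∪ ⁅ j ⁆) ++_) (∪-identityʳ Y) ⟩
    (Z ∪ ⁅ j ⁆) ++ Y         ∎
    where
    open ≡-Reasoning
    ⁅↑ˡ⁆ : ∀ {m} (j : Fin m) → ⁅ j ↑ˡ n ⁆ ≡ ⁅ j ⁆ ++ ⊥ {n}
    ⁅↑ˡ⁆ {suc m} zero = cong (true ∷_) (sym (⊥++⊥ {m}))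
    ⁅↑ˡ⁆ (suc j) = cong (false ∷_) (⁅↑ˡ⁆ j)

  ++-∪⁅↑ʳ⁆ : ∀ (Z : Subset m) (Y : Subset n) k → (Z ++ Y) ∪ ⁅ m ↑ʳ k ⁆ ≡ Z ++ (Y ∪ ⁅ k ⁆)
  ++-∪⁅↑ʳ⁆ Z Y k = begin
    (Z ++ Y) ∪ ⁅ m ↑ʳ k ⁆    ≡⟨ cong ((Z ++ Y) ∪_) (⁅↑ʳ⁆ m) ⟩
    (Z ++ Y) ∪ (⊥ ++ ⁅ k ⁆)  ≡⟨ ∪-++ Z ⊥ Y ⁅ k ⁆ ⟩
    (Z ∪ ⊥) ++ (Y ∪ ⁅ k ⁆)   ≡⟨ cong (_++ (Y ∪ ⁅ k ⁆)) (∪-identityʳ Z) ⟩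
    Z ++ (Y ∪ ⁅ k ⁆)         ∎
    where
    open ≡-Reasoning
    ⁅↑ʳ⁆ : ∀ m → ⁅ m ↑ʳ k ⁆ ≡ ⊥ {m} ++ ⁅ k ⁆
    ⁅↑ʳ⁆ zero    = refl
    ⁅↑ʳ⁆ (suc m) = cong (false ∷_) (⁅↑ʳ⁆ m)

  ↑ˡ∈++⁺ : ∀ {Z : Subset m} {Y : Subset n} {j} → j ∈ Z → j ↑ˡ n ∈ Z ++ Y
  ↑ˡ∈++⁺ {Z} {Y} {j} j∈Z = lookup⇒∈ (trans (lookup-++ˡ Z Y j) (∈⇒lookup j∈Z))

  ↑ˡ∈++⁻ : ∀ {Z : Subset m} {Y : Subset n} {j} → j ↑ˡ n ∈ Z ++ Y → j ∈ Z
  ↑ˡ∈++⁻ {Z} {Y} {j} j∈ = lookup⇒∈ (trans (sym (lookup-++ˡ Z Y j)) (∈⇒lookup j∈))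

  ↑ʳ∈++⁺ : ∀ {Z : Subset m} {Y : Subset n} {k} → k ∈ Y → m ↑ʳ k ∈ Z ++ Y
  ↑ʳ∈++⁺ {Z} {Y} {k} k∈Y = lookup⇒∈ (trans (lookup-++ʳ Z Y k) (∈⇒lookup k∈Y))

  ↑ʳ∈++⁻ : ∀ {Z : Subset m} {Y : Subset n} {k} → m ↑ʳ k ∈ Z ++ Y → k ∈ Y
  ↑ʳ∈++⁻ {Z} {Y} {k} k∈ = lookup⇒∈ (trans (sym (lookup-++ʳ Z Y k)) (∈⇒lookup k∈))

  ++-⊆⁻ : ∀ {Z Z′ : Subset m} {Y Y′ : Subset n} → Z ++ Y ⊆ Z′ ++ Y′ → Z ⊆ Z′ × Y ⊆ Y′
  ++-⊆⁻ ⊆′ = ↑ˡ∈++⁻ ∘ ⊆′ ∘ ↑ˡ∈++⁺ , ↑ʳ∈++⁻ ∘ ⊆′ ∘ ↑ʳ∈++⁺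

module _ {m n} (M₁ : IndependenceMatroid m) (M₂ : IndependenceMatroid n) where
  private
    module M₁ = IndependenceMatroid M₁
    module M₂ = IndependenceMatroid M₂

  DirectSumIndependent : Subset (m + n) → Set
  DirectSumIndependent V = ∃₂ λ I₁ I₂ → M₁.Independent I₁ × M₂.Independent I₂ × V ≡ I₁ ++ I₂

  directSum : IndependenceMatroid (m + n)
  directSum = record
    { Independent   = DirectSumIndependent
    ; independent-⊆ = independent-⊆
    ; augment       = augment
    }
    where
    independent-⊆ : ∀ {W V} → W ⊆ V → DirectSumIndependent V → DirectSumIndependent W
    independent-⊆ {W} W⊆V (I₁ , I₂ , i₁ , i₂ , refl) with Vec.splitAt m W
    ... | Z , Y , refl = let Z⊆I₁ , Y⊆I₂ = ++-⊆⁻ W⊆V in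
                         Z , Y , M₁.independent-⊆ Z⊆I₁ i₁ , M₂.independent-⊆ Y⊆I₂ i₂ , refl
    augment : ∀ {V W} → DirectSumIndependent V → DirectSumIndependent W → ∣ V ∣ < ∣ W ∣ →
              ∃ λ e → e ∈ W × e ∉ V × DirectSumIndependent (V ∪ ⁅ e ⁆)
    augment (A₁ , A₂ , a₁ , a₂ , refl) (B₁ , B₂ , b₁ , b₂ , refl) ∣V∣<∣W∣ with ∣ A₁ ∣ <? ∣ B₁ ∣
    ... | yes ∣A₁∣<∣B₁∣ =
      let e , e∈B₁ , e∉A₁ , a₁+e = M₁.augment a₁ b₁ ∣A₁∣<∣B₁∣ in
      e ↑ˡ n , ↑ˡ∈++⁺ e∈B₁ , e∉A₁ ∘ ↑ˡ∈++⁻ , A₁ ∪ ⁅ e ⁆ , A₂ , a₁+e , a₂ , ++-∪⁅↑ˡ⁆ A₁ A₂ e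
    ... | no  ∣A₁∣≮∣B₁∣ =
      let e , e∈B₂ , e∉A₂ , a₂+e = M₂.augment a₂ b₂ ∣A₂∣<∣B₂∣ in
      m ↑ʳ e , ↑ʳ∈++⁺ e∈B₂ , e∉A₂ ∘ ↑ʳ∈++⁻ , A₁ , A₂ ∪ ⁅ e ⁆ , a₁ , a₂+e , ++-∪⁅↑ʳ⁆ A₁ A₂ e
      where
      ∣A₂∣<∣B₂∣ : ∣ A₂ ∣ < ∣ B₂ ∣
      ∣A₂∣<∣B₂∣ = +-cancelˡ-< (∣ B₁ ∣) (∣ A₂ ∣) (∣ B₂ ∣) (begin-strict
        ∣ B₁ ∣ + ∣ A₂ ∣  ≤⟨ +-monoˡ-≤ (∣ A₂ ∣) (≮⇒≥ ∣A₁∣≮∣B₁∣) ⟩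
        ∣ A₁ ∣ + ∣ A₂ ∣  ≡⟨ ∣++∣ A₁ A₂ ⟨
        ∣ A₁ ++ A₂ ∣     <⟨ ∣V∣<∣W∣ ⟩
        ∣ B₁ ++ B₂ ∣     ≡⟨ ∣++∣ B₁ B₂ ⟩
        ∣ B₁ ∣ + ∣ B₂ ∣  ∎)
        where open ≤-Reasoning

module Union {n} (M₁ M₂ : IndependenceMatroid n) where
  private
    module M₁ = IndependenceMatroid M₁
    module M₂ = IndependenceMatroid M₂

  -- I₁ and I₂ side by side, except that the elements of I₂ ∩ D are moved onto their copies in I₁.
  glue : Subset n → Subset n → Subset n → Subset (n + n)
  glue D I₁ I₂ = (I₁ ∪ (I₂ ∩ D)) ++ (I₂ ─ D)

  Glued : Subset n → Subset (n + n) → Set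
  Glued D V = ∃₂ λ I₁ I₂ → M₁.Independent I₁ × M₂.Independent I₂ ×
                (∀ {j} → j ∈ D → j ∈ I₁ → j ∉ I₂) × V ≡ glue D I₁ I₂

  lookup-glue-↑ˡ : ∀ D I₁ I₂ j → lookup (glue D I₁ I₂) (j ↑ˡ n) ≡ (lookup I₁ j ∨ (lookup I₂ j ∧ lookup D j))
  lookup-glue-↑ˡ D I₁ I₂ j =
    trans (lookup-++ˡ (I₁ ∪ (I₂ ∩ D)) (I₂ ─ D) j)
          (trans (lookup-∪ I₁ (I₂ ∩ D) j) (cong (lookup I₁ j ∨_) (lookup-∩ I₂ D j)))

  lookup-glue-↑ʳ : ∀ D I₁ I₂ j → lookup (glue D I₁ I₂) (n ↑ʳ j) ≡ (lookup I₂ j ∧ not (lookup D j))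
  lookup-glue-↑ʳ D I₁ I₂ j = trans (lookup-++ʳ (I₁ ∪ (I₂ ∩ D)) (I₂ ─ D) j) (lookup-─ I₂ D j)

  -- Gluing one more element k ∈ D is identifying the two copies of k.
  module GlueStep (D : Subset n) (k : Fin n) (k∈D : k ∈ D) (N : IndependenceMatroid (n + n))
                  (N≡ : IndependenceMatroid.Independent N ≡ Glued (D ─ ⁅ k ⁆)) where
    open Identify N (k ↑ˡ n) (n ↑ʳ k) (↑ˡ≢↑ʳ k k) using (Renames; Independent′; identifiedMatroid)

    D′ : Subset n
    D′ = D ─ ⁅ k ⁆

    D′k : lookup D′ k ≡ false
    D′k = ∉⇒lookup {p = D′} (λ k∈D′ → proj₂ (x∈p─q⁻ {p = D} k∈D′) (x∈⁅x⁆ k))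

    D′j : ∀ {j} → j ≢ k → lookup D′ j ≡ lookup D j
    D′j {j} j≢k = trans (lookup-─ D ⁅ k ⁆ j) (trans (cong (λ b → lookup D j ∧ not b) (∉⇒lookup (x≢y⇒x∉⁅y⁆ j≢k)))
                    (∧-identityʳ _))

    module _ (I₁ I₂ : Subset n) where
      glue′-at-k-left : lookup (glue D′ I₁ I₂) (k ↑ˡ n) ≡ lookup I₁ k
      glue′-at-k-left rewrite lookup-glue-↑ˡ D′ I₁ I₂ k | D′k | ∧-zeroʳ (lookup I₂ k) = ∨-identityʳ _

      glue′-at-k-right : lookup (glue D′ I₁ I₂) (n ↑ʳ k) ≡ lookup I₂ k
      glue′-at-k-right rewrite lookup-glue-↑ʳ D′ I₁ I₂ k | D′k = ∧-identityʳ _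

      glue-at-k-left : lookup (glue D I₁ I₂) (k ↑ˡ n) ≡ (lookup I₁ k ∨ lookup I₂ k)
      glue-at-k-left rewrite lookup-glue-↑ˡ D I₁ I₂ k | ∈⇒lookup k∈D | ∧-identityʳ (lookup I₂ k) = refl

      glue-at-k-right : lookup (glue D I₁ I₂) (n ↑ʳ k) ≡ false
      glue-at-k-right rewrite lookup-glue-↑ʳ D I₁ I₂ k | ∈⇒lookup k∈D = ∧-zeroʳ _

      glue′-elsewhere : ∀ {i} → i ≢ k ↑ˡ n → i ≢ n ↑ʳ k → lookup (glue D′ I₁ I₂) i ≡ lookup (glue D I₁ I₂) i
      glue′-elsewhere {i} i≢x i≢y with ↑-view n i
      ... | left j  = trans (lookup-glue-↑ˡ D′ I₁ I₂ j)
          (trans (cong (λ b → lookup I₁ j ∨ (lookup I₂ j ∧ b)) (D′j λ { refl → i≢x refl }))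
                 (sym (lookup-glue-↑ˡ D I₁ I₂ j)))
      ... | right j = trans (lookup-glue-↑ʳ D′ I₁ I₂ j)
          (trans (cong (λ b → lookup I₂ j ∧ not b) (D′j λ { refl → i≢y refl }))
                 (sym (lookup-glue-↑ʳ D I₁ I₂ j)))

    glued⇒identified : ∀ {V} → Glued D V → Independent′ V
    glued⇒identified (I₁ , I₂ , i₁ , i₂ , disjoint , refl) =
      glue D′ I₁ I₂ ,
      subst (λ Ind → Ind (glue D′ I₁ I₂)) (sym N≡) (I₁ , I₂ , i₁ , i₂ , disjoint ∘ proj₁ ∘ x∈p─q⁻ , refl) ,
      record
        { y∉I       = glue-at-k-right I₁ I₂
        ; elsewhere = glue′-elsewhere I₁ I₂
        ; x-or-y    = trans (cong₂ _∨_ (glue′-at-k-left I₁ I₂) (glue′-at-k-right I₁ I₂)) (sym (glue-at-k-left I₁ I₂))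
        ; not-both  = trans (cong₂ _∧_ (glue′-at-k-left I₁ I₂) (glue′-at-k-right I₁ I₂)) not-both-at-k
        }
      where
      not-both-at-k : (lookup I₁ k ∧ lookup I₂ k) ≡ false
      not-both-at-k with lookup I₁ k in I₁k
      ... | false = refl
      ... | true  = ∉⇒lookup (disjoint k∈D (lookup⇒∈ I₁k))

    identified⇒glued : ∀ {V} → Independent′ V → Glued D V
    identified⇒glued {V} (J , iJ , r) with subst (λ Ind → Ind J) N≡ iJ
    ... | I₁ , I₂ , i₁ , i₂ , disjoint′ , refl = I₁ , I₂ , i₁ , i₂ , disjoint , ++-ext onLeft onRight
      where
      open Renames r
      not-both-at-k : (lookup I₁ k ∧ lookup I₂ k) ≡ false
      not-both-at-k = trans (sym (cong₂ _∧_ (glue′-at-k-left I₁ I₂) (glue′-at-k-right I₁ I₂))) not-both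
      disjoint : ∀ {j} → j ∈ D → j ∈ I₁ → j ∉ I₂
      disjoint {j} j∈D j∈I₁ j∈I₂ with j ≟ k
      ... | yes refl with trans (sym (cong₂ _∧_ (∈⇒lookup j∈I₁) (∈⇒lookup j∈I₂))) not-both-at-k
      ...   | ()
      disjoint {j} j∈D j∈I₁ j∈I₂ | no j≢k = disjoint′ (x∈p∧x≢y⇒x∈p-y j∈D j≢k) j∈I₁ j∈I₂
      onLeft : ∀ j → lookup V (j ↑ˡ n) ≡ lookup (glue D I₁ I₂) (j ↑ˡ n)
      onLeft j with j ≟ k
      ... | yes refl = trans (sym x-or-y) (trans (cong₂ _∨_ (glue′-at-k-left I₁ I₂) (glue′-at-k-right I₁ I₂))
                         (sym (glue-at-k-left I₁ I₂)))
      ... | no  j≢k  = trans (sym (elsewhere (j≢k ∘ ↑ˡ-injective n j k) (↑ˡ≢↑ʳ j k)))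
                         (glue′-elsewhere I₁ I₂ (j≢k ∘ ↑ˡ-injective n j k) (↑ˡ≢↑ʳ j k))
      onRight : ∀ j → lookup V (n ↑ʳ j) ≡ lookup (glue D I₁ I₂) (n ↑ʳ j)
      onRight j with j ≟ k
      ... | yes refl = trans y∉I (sym (glue-at-k-right I₁ I₂))
      ... | no  j≢k  = trans (sym (elsewhere (↑ˡ≢↑ʳ k j ∘ sym) (j≢k ∘ ↑ʳ-injective n j k)))
                         (glue′-elsewhere I₁ I₂ (↑ˡ≢↑ʳ k j ∘ sym) (j≢k ∘ ↑ʳ-injective n j k))

    gluedMatroid : IndependenceMatroid (n + n)
    gluedMatroid = withIndependence identifiedMatroid (Glued D) glued⇒identified identified⇒glued

  gluedMatroid : ∀ D → Σ (IndependenceMatroid (n + n)) λ N → IndependenceMatroid.Independent N ≡ Glued D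
  gluedMatroid D = go D (⊂-wellFounded D)
    where
    go : ∀ D → Acc _⊂_ D → Σ (IndependenceMatroid (n + n)) λ N → IndependenceMatroid.Independent N ≡ Glued D
    go D (acc rec) with any? (_∈? D)
    ... | yes (k , k∈D) = let N , N≡ = go (D ─ ⁅ k ⁆) (rec (x∈p⇒p-x⊂p k∈D)) in
                          GlueStep.gluedMatroid D k k∈D N N≡ , refl
    ... | no  D-empty rewrite Empty-unique D-empty =
      withIndependence (directSum M₁ M₂) (Glued ⊥) to from , refl
      where
      glue-⊥ : ∀ I₁ I₂ → glue ⊥ I₁ I₂ ≡ I₁ ++ I₂
      glue-⊥ I₁ I₂ = cong₂ _++_ (trans (cong (I₁ ∪_) (∩-zeroʳ I₂)) (∪-identityʳ I₁)) (p─⊥≡p I₂)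
      to : ∀ {V} → Glued ⊥ V → DirectSumIndependent M₁ M₂ V
      to (I₁ , I₂ , i₁ , i₂ , _ , refl) = I₁ , I₂ , i₁ , i₂ , glue-⊥ I₁ I₂
      from : ∀ {V} → DirectSumIndependent M₁ M₂ V → Glued ⊥ V
      from (I₁ , I₂ , i₁ , i₂ , refl) = I₁ , I₂ , i₁ , i₂ , (λ j∈⊥ → ⊥-elim (∉⊥ j∈⊥)) , sym (glue-⊥ I₁ I₂)

  UnionIndependent : Subset n → Set
  UnionIndependent Z = ∃₂ λ I₁ I₂ → M₁.Independent I₁ × M₂.Independent I₂ × Z ⊆ I₁ ∪ I₂

  private
    N = proj₁ (gluedMatroid ⊤)
    module N = IndependenceMatroid N

    glue-⊤ : ∀ I₁ I₂ → glue ⊤ I₁ I₂ ≡ (I₁ ∪ I₂) ++ ⊥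
    glue-⊤ I₁ I₂ = cong₂ _++_ (cong (I₁ ∪_) (∩-identityʳ I₂)) (p─⊤≡⊥ I₂)

    union⇒glued : ∀ {Z} → UnionIndependent Z → N.Independent (Z ++ ⊥)
    union⇒glued {Z} (I₁ , I₂ , i₁ , i₂ , Z⊆I₁∪I₂) =
      subst (λ Ind → Ind (Z ++ ⊥)) (sym (proj₂ (gluedMatroid ⊤)))
        (Z ∩ I₁ , Z ─ I₁ , M₁.independent-⊆ (p∩q⊆q Z I₁) i₁ , M₂.independent-⊆ Z─I₁⊆I₂ i₂ ,
         (λ _ j∈Z∩I₁ j∈Z─I₁ → proj₂ (x∈p─q⁻ j∈Z─I₁) (proj₂ (x∈p∩q⁻ Z I₁ j∈Z∩I₁))) ,
         trans (cong (_++ ⊥) (sym (p∩q∪p─q≡p Z I₁))) (sym (glue-⊤ (Z ∩ I₁) (Z ─ I₁))))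
      where
      Z─I₁⊆I₂ : Z ─ I₁ ⊆ I₂
      Z─I₁⊆I₂ j∈ with x∈p─q⁻ j∈
      ... | j∈Z , j∉I₁ = [ ⊥-elim ∘ j∉I₁ , id ]′ (x∈p∪q⁻ I₁ I₂ (Z⊆I₁∪I₂ j∈Z))

    glued⇒union : ∀ {Z} → N.Independent (Z ++ ⊥) → UnionIndependent Z
    glued⇒union {Z} iZ with subst (λ Ind → Ind (Z ++ ⊥)) (proj₂ (gluedMatroid ⊤)) iZ
    ... | I₁ , I₂ , i₁ , i₂ , _ , Z++⊥≡ =
      I₁ , I₂ , i₁ , i₂ , ⊆-reflexive (++-injectiveˡ Z (I₁ ∪ I₂) (trans Z++⊥≡ (glue-⊤ I₁ I₂)))

    union-augment : ∀ {Z W} → UnionIndependent Z → UnionIndependent W → ∣ Z ∣ < ∣ W ∣ →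
                    ∃ λ x → x ∈ W × x ∉ Z × UnionIndependent (Z ∪ ⁅ x ⁆)
    union-augment {Z} {W} iZ iW ∣Z∣<∣W∣ with N.augment (union⇒glued iZ) (union⇒glued iW) ∣Z++⊥∣<∣W++⊥∣
      where
      ∣Y++⊥∣≡∣Y∣ : ∀ Y → ∣ Y ++ ⊥ {n} ∣ ≡ ∣ Y ∣
      ∣Y++⊥∣≡∣Y∣ Y = trans (∣++∣ Y ⊥) (trans (cong (λ k → ∣ Y ∣ + k) (∣⊥∣≡0 n)) (+-identityʳ _))
      ∣Z++⊥∣<∣W++⊥∣ : ∣ Z ++ ⊥ ∣ < ∣ W ++ ⊥ ∣
      ∣Z++⊥∣<∣W++⊥∣ = subst₂ _<_ (sym (∣Y++⊥∣≡∣Y∣ Z)) (sym (∣Y++⊥∣≡∣Y∣ W)) ∣Z∣<∣W∣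
    ... | e , e∈ , e∉ , iZ+e with ↑-view n e
    ...   | right k = ⊥-elim (∉⊥ (↑ʳ∈++⁻ {Z = W} e∈))
    ...   | left  k = k , ↑ˡ∈++⁻ e∈ , e∉ ∘ ↑ˡ∈++⁺ , glued⇒union (subst N.Independent (++-∪⁅↑ˡ⁆ Z ⊥ k) iZ+e)

  unionMatroid : IndependenceMatroid n
  unionMatroid = record
    { Independent   = UnionIndependent
    ; independent-⊆ = λ Z⊆W (I₁ , I₂ , i₁ , i₂ , W⊆) → I₁ , I₂ , i₁ , i₂ , ⊆-trans Z⊆W W⊆
    ; augment       = union-augment
    }

-- The decomposition S ⊎ P ⊎ Q

max+min≡const : ∀ {X : Set} {Good : X → X → Set} (f g : X → X → ℕ) {K r s : ℕ} →
                (∀ {a c} → Good a c → f a c + g a c ≡ K) →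
                (∀ {a c} → Good a c → f a c ≤ r) → (∃₂ λ a c → Good a c × r ≡ f a c) →
                (∃₂ λ a c → Good a c × s ≡ g a c × (∀ {a′ c′} → Good a′ c′ → g a c ≤ g a′ c′)) →
                r + s ≡ K
max+min≡const f g {K} {r} {s} f+g≡K f≤r (a , c , ac , r≡) (a′ , c′ , ac′ , s≡ , g-min) = ≤-antisym
  (begin
    r + s              ≡⟨ cong₂ _+_ r≡ s≡ ⟩
    f a c + g a′ c′    ≤⟨ +-monoʳ-≤ (f a c) (g-min ac) ⟩
    f a c + g a c      ≡⟨ f+g≡K ac ⟩
    K                  ∎)
  (begin
    K                  ≡⟨ f+g≡K ac′ ⟨
    f a′ c′ + g a′ c′  ≤⟨ +-monoˡ-≤ (g a′ c′) (f≤r ac′) ⟩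
    r + g a′ c′        ≡⟨ cong (λ k → r + k) s≡ ⟨
    r + s              ∎)
  where open ≤-Reasoning

data Region : Bool → Bool → Bool → Set where
  inS : Region true  false false
  inP : Region false true  false
  inQ : Region false false true

module Decomposition {n} (S P Q : Subset n) (isA isC : Subset n → Bool)
                     (isMatroidA : IsMatroid (mkSS (S ∪ P) isA)) (isMatroidC : IsMatroid (mkSS (P ∪ Q) isC))
                     (S∩P≡∅ : Empty (S ∩ P)) (P∩Q≡∅ : Empty (P ∩ Q)) (S∩Q≡∅ : Empty (S ∩ Q))
                     (S∪P∪Q≡⊤ : S ∪ P ∪ Q ≡ ⊤) where

  MA MC J W : SetSystem n
  MA = mkSS (S ∪ P) isA
  MC = mkSS (P ∪ Q) isC
  J  = joinSPQ S Q MA MC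
  W  = meetSPQ S Q MA MC

  G : Subset n
  G = (S ∪ P) ∪ Q

  ⊆G : ∀ (x : Subset n) → x ⊆ G
  ⊆G x _ = subst (_ ∈_) (sym (trans (∪-assoc S P Q) S∪P∪Q≡⊤)) ∈⊤

  Bases : Subset n → Subset n → Set
  Bases a c = T (isA a) × T (isC c)

  meet : Subset n → Subset n → Subset n
  meet a c = (a ∪ Q) ∩ (c ∪ S)

  co : Subset n → Subset n → Subset n
  co a c = ((S ∪ P) ─ a) ∪ ((P ∪ Q) ─ c)

  region : ∀ i → Region (lookup S i) (lookup P i) (lookup Q i)
  region i = classify (lookup S i) (lookup P i) (lookup Q i)
                      covered (disjoint S∩P≡∅) (disjoint P∩Q≡∅) (disjoint S∩Q≡∅)
    where
    disjoint : ∀ {X Y} → Empty (X ∩ Y) → (lookup X i ∧ lookup Y i) ≡ false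
    disjoint {X} {Y} X∩Y≡∅ with lookup X i in Xi | lookup Y i in Yi
    ... | true  | true  = ⊥-elim (X∩Y≡∅ (i , x∈p∩q⁺ (lookup⇒∈ Xi , lookup⇒∈ Yi)))
    ... | true  | false = refl
    ... | false | _     = refl
    covered : (lookup S i ∨ (lookup P i ∨ lookup Q i)) ≡ true
    covered = trans (sym (trans (lookup-∪ S (P ∪ Q) i) (cong (lookup S i ∨_) (lookup-∪ P Q i))))
                    (trans (cong (λ v → lookup v i) S∪P∪Q≡⊤) (lookup-⊤ i))
    classify : ∀ s p q → (s ∨ (p ∨ q)) ≡ true → (s ∧ p) ≡ false → (p ∧ q) ≡ false → (s ∧ q) ≡ false →
               Region s p q
    classify true  false false _ _ _ _ = inS
    classify false true  false _ _ _ _ = inP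
    classify false false true  _ _ _ _ = inQ
    classify true  true  _     _ () _ _
    classify true  false true  _ _ _ ()
    classify false true  true  _ _ () _
    classify false false false () _ _ _

  lookup-base : ∀ {X Y a : Subset n} → a ⊆ X ∪ Y → ∀ i → lookup a i ≡ true → (lookup X i ∨ lookup Y i) ≡ true
  lookup-base {X} {Y} a⊆X∪Y i ai = trans (sym (lookup-∪ X Y i)) (⊆⇒lookup a⊆X∪Y ai)

  -- Set identities about a and c are checked position by position: there exactly one of S, P, Q
  -- holds, a can only occur in S ∪ P and c only in P ∪ Q.
  private
    module _ {s p q : Bool} where
      co-meet-at : Region s p q → ∀ a c → (a ≡ true → (s ∨ p) ≡ true) → (c ≡ true → (p ∨ q) ≡ true) →
                   (((s ∨ p) ∨ q) ∧ not ((a ∨ q) ∧ (c ∨ s))) ≡ (((s ∨ p) ∧ not a) ∨ ((p ∨ q) ∧ not c))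
      co-meet-at inS a     true  _  c∈ with c∈ refl
      ... | ()
      co-meet-at inS true  false _  _  = refl
      co-meet-at inS false false _  _  = refl
      co-meet-at inP true  true  _  _  = refl
      co-meet-at inP true  false _  _  = refl
      co-meet-at inP false true  _  _  = refl
      co-meet-at inP false false _  _  = refl
      co-meet-at inQ true  c     a∈ _  with a∈ refl
      ... | ()
      co-meet-at inQ false true  _  _  = refl
      co-meet-at inQ false false _  _  = refl

      core-at : Region s p q → ∀ a c → (a ≡ true → (s ∨ p) ≡ true) → (c ≡ true → (p ∨ q) ≡ true) →
                (p ∧ not ((((s ∨ p) ∨ q) ∧ not ((a ∨ q) ∧ (c ∨ s))) ∧ p)) ≡ (a ∧ c)
      core-at inS a     true  _  c∈ with c∈ refl
      ... | ()
      core-at inS a     false _  _  = sym (∧-zeroʳ a)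
      core-at inP true  true  _  _  = refl
      core-at inP true  false _  _  = refl
      core-at inP false c     _  _  = refl
      core-at inQ true  c     a∈ _  with a∈ refl
      ... | ()
      core-at inQ false c     _  _  = refl

      count-at : Region s p q → ∀ a c → (a ≡ true → (s ∨ p) ≡ true) → (c ≡ true → (p ∨ q) ≡ true) →
                 χ ((a ∨ c) ∧ p) + χ ((a ∨ q) ∧ (c ∨ s)) ≡ χ a + χ c
      count-at inS a     true  _  c∈ with c∈ refl
      ... | ()
      count-at inS true  false _  _  = refl
      count-at inS false false _  _  = refl
      count-at inP true  true  _  _  = refl
      count-at inP true  false _  _  = refl
      count-at inP false true  _  _  = refl
      count-at inP false false _  _  = refl
      count-at inQ true  c     a∈ _  with a∈ refl
      ... | ()
      count-at inQ false true  _  _  = refl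
      count-at inQ false false _  _  = refl

  base-⊆SP : ∀ {a} → T (isA a) → a ⊆ S ∪ P
  base-⊆SP = IsMatroid.bases-in-ground isMatroidA _

  base-⊆PQ : ∀ {c} → T (isC c) → c ⊆ P ∪ Q
  base-⊆PQ = IsMatroid.bases-in-ground isMatroidC _

  lookup-G─meet : ∀ a c i → lookup (G ─ meet a c) i ≡
                  (((lookup S i ∨ lookup P i) ∨ lookup Q i) ∧
                   not ((lookup a i ∨ lookup Q i) ∧ (lookup c i ∨ lookup S i)))
  lookup-G─meet a c i
    rewrite lookup-─ G (meet a c) i | lookup-∪ (S ∪ P) Q i | lookup-∪ S P i
          | lookup-∩ (a ∪ Q) (c ∪ S) i | lookup-∪ a Q i | lookup-∪ c S i = refl

  co-meet : ∀ {a c} → Bases a c → G ─ meet a c ≡ co a c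
  co-meet {a} {c} (Ba , Bc) = lookup-ext λ i → begin
    lookup (G ─ meet a c) i
      ≡⟨ lookup-G─meet a c i ⟩
    ((lookup S i ∨ lookup P i) ∨ lookup Q i) ∧ not ((lookup a i ∨ lookup Q i) ∧ (lookup c i ∨ lookup S i))
      ≡⟨ co-meet-at (region i) (lookup a i) (lookup c i) (lookup-base (base-⊆SP Ba) i) (lookup-base (base-⊆PQ Bc) i) ⟩
    ((lookup S i ∨ lookup P i) ∧ not (lookup a i)) ∨ ((lookup P i ∨ lookup Q i) ∧ not (lookup c i))
      ≡⟨ cong₂ _∨_ (cong (_∧ not (lookup a i)) (lookup-∪ S P i)) (cong (_∧ not (lookup c i)) (lookup-∪ P Q i)) ⟨
    (lookup (S ∪ P) i ∧ not (lookup a i)) ∨ (lookup (P ∪ Q) i ∧ not (lookup c i))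
      ≡⟨ cong₂ _∨_ (lookup-─ (S ∪ P) a i) (lookup-─ (P ∪ Q) c i) ⟨
    lookup ((S ∪ P) ─ a) i ∨ lookup ((P ∪ Q) ─ c) i
      ≡⟨ lookup-∪ ((S ∪ P) ─ a) ((P ∪ Q) ─ c) i ⟨
    lookup (co a c) i ∎
    where open ≡-Reasoning

  P─[G─meet∩P]≡a∩c : ∀ {a c} → Bases a c → P ─ ((G ─ meet a c) ∩ P) ≡ a ∩ c
  P─[G─meet∩P]≡a∩c {a} {c} (Ba , Bc) = lookup-ext λ i → begin
    lookup (P ─ ((G ─ meet a c) ∩ P)) i
      ≡⟨ lookup-─ P ((G ─ meet a c) ∩ P) i ⟩
    lookup P i ∧ not (lookup ((G ─ meet a c) ∩ P) i)
      ≡⟨ cong (λ b → lookup P i ∧ not b) (trans (lookup-∩ (G ─ meet a c) P i) (cong (_∧ lookup P i) (lookup-G─meet a c i))) ⟩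
    lookup P i ∧ not ((((lookup S i ∨ lookup P i) ∨ lookup Q i) ∧
                        not ((lookup a i ∨ lookup Q i) ∧ (lookup c i ∨ lookup S i))) ∧ lookup P i)
      ≡⟨ core-at (region i) (lookup a i) (lookup c i) (lookup-base (base-⊆SP Ba) i) (lookup-base (base-⊆PQ Bc) i) ⟩
    lookup a i ∧ lookup c i
      ≡⟨ lookup-∩ a c i ⟨
    lookup (a ∩ c) i ∎
    where open ≡-Reasoning

  ∣[a∪c]∩P∣+∣meet∣≡∣a∣+∣c∣ : ∀ {a c} → Bases a c → ∣ (a ∪ c) ∩ P ∣ + ∣ meet a c ∣ ≡ ∣ a ∣ + ∣ c ∣
  ∣[a∪c]∩P∣+∣meet∣≡∣a∣+∣c∣ {a} {c} (Ba , Bc) = ∣∣-pointwise ((a ∪ c) ∩ P) (meet a c) a c pointwise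
    where
    pointwise : ∀ i → χ (lookup ((a ∪ c) ∩ P) i) + χ (lookup (meet a c) i) ≡ χ (lookup a i) + χ (lookup c i)
    pointwise i rewrite lookup-∩ (a ∪ c) P i | lookup-∪ a c i | lookup-∩ (a ∪ Q) (c ∪ S) i
                      | lookup-∪ a Q i | lookup-∪ c S i =
      count-at (region i) (lookup a i) (lookup c i) (lookup-base (base-⊆SP Ba) i) (lookup-base (base-⊆PQ Bc) i)

  U : IndependenceMatroid n
  U = Union.unionMatroid (BaseMatroid.independenceMatroid (dual MA) (dual-isMatroid MA isMatroidA))
                         (BaseMatroid.independenceMatroid (dual MC) (dual-isMatroid MC isMatroidC))
  open IndependenceMatroid U using (MaximalIndependentIn; maximal-independent-is-largest)
    renaming (Independent to U-Independent)

  co-independent : ∀ {a c Y} → Bases a c → Y ⊆ co a c → U-Independent Y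
  co-independent (Ba , Bc) Y⊆co =
    _ , _ , (_ , dual-base-of MA isMatroidA Ba , ⊆-refl) , (_ , dual-base-of MC isMatroidC Bc , ⊆-refl) , Y⊆co

  independent⇒⊆co : ∀ {Y} → U-Independent Y → ∃₂ λ a c → Bases a c × Y ⊆ co a c
  independent⇒⊆co (I₁ , I₂ , (b₁ , Db₁ , I₁⊆b₁) , (b₂ , Db₂ , I₂⊆b₂) , Y⊆I₁∪I₂)
    with dual-base-is MA Db₁ | dual-base-is MC Db₂
  ... | a , Ba , refl | c , Bc , refl = a , c , (Ba , Bc) , ⊆-trans Y⊆I₁∪I₂ (∪-mono I₁⊆b₁ I₂⊆b₂)

  -- The bases of J, W, restrict J P and restrict (dual W) P are, by definition, the maximal,
  -- minimal, maximal and maximal members of these families.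
  JoinFamily MeetFamily RestrictFamily ContractFamily : Subset n → Bool
  JoinFamily     = image₂Of isA isC _∪_
  MeetFamily     = image₂Of (imageOf isA (_∪ Q)) (imageOf isC (_∪ S)) _∩_
  RestrictFamily = imageOf (isBase J) (_∩ P)
  ContractFamily = imageOf (isBase (dual W)) (_∩ P)

  join-family⁺ : ∀ {a c} → Bases a c → T (JoinFamily (a ∪ c))
  join-family⁺ (Ba , Bc) = image₂Of⁺ isA isC _∪_ Ba Bc

  join-family⁻ : ∀ {d} → T (JoinFamily d) → ∃₂ λ a c → Bases a c × d ≡ a ∪ c
  join-family⁻ {d} Fd = let a , c , Ba , Bc , a∪c≡d = image₂Of⁻ isA isC _∪_ {d} Fd in a , c , (Ba , Bc) , sym a∪c≡d

  meet-family⁺ : ∀ {a c} → Bases a c → T (MeetFamily (meet a c))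
  meet-family⁺ (Ba , Bc) =
    image₂Of⁺ (imageOf isA (_∪ Q)) (imageOf isC (_∪ S)) _∩_ (imageOf⁺ isA (_∪ Q) Ba) (imageOf⁺ isC (_∪ S) Bc)

  meet-family⁻ : ∀ {x} → T (MeetFamily x) → ∃₂ λ a c → Bases a c × x ≡ meet a c
  meet-family⁻ {x} Fx with image₂Of⁻ (imageOf isA (_∪ Q)) (imageOf isC (_∪ S)) _∩_ {x} Fx
  ... | _ , _ , Fa′ , Fc′ , refl with imageOf⁻ isA (_∪ Q) Fa′ | imageOf⁻ isC (_∪ S) Fc′
  ...   | a , Ba , refl | c , Bc , refl = a , c , (Ba , Bc) , refl

  a₀ c₀ : Subset n
  a₀ = proj₁ (IsMatroid.base-exists isMatroidA)
  c₀ = proj₁ (IsMatroid.base-exists isMatroidC)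

  Bases₀ : Bases a₀ c₀
  Bases₀ = proj₂ (IsMatroid.base-exists isMatroidA) , proj₂ (IsMatroid.base-exists isMatroidC)

  ∣a∣+∣c∣≡∣a₀∣+∣c₀∣ : ∀ {a c} → Bases a c → ∣ a ∣ + ∣ c ∣ ≡ ∣ a₀ ∣ + ∣ c₀ ∣
  ∣a∣+∣c∣≡∣a₀∣+∣c₀∣ (Ba , Bc) = cong₂ _+_ (BaseMatroid.∣base∣≡∣base∣ MA isMatroidA Ba (proj₁ Bases₀))
                                          (BaseMatroid.∣base∣≡∣base∣ MC isMatroidC Bc (proj₂ Bases₀))

  ∣a∪c∣≤rank-J : ∀ {a c} → Bases a c → ∣ a ∪ c ∣ ≤ rank J
  ∣a∪c∣≤rank-J = ∣∣≤rank-maximalIn G JoinFamily ∘ join-family⁺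

  rank-J-attained : ∃₂ λ a c → Bases a c × rank J ≡ ∣ a ∪ c ∣
  rank-J-attained =
    let d , Fd , rank≡     = rank-maximalIn-attained G JoinFamily (join-family⁺ Bases₀)
        a , c , Bac , d≡a∪c = join-family⁻ Fd
    in a , c , Bac , trans rank≡ (cong ∣_∣ d≡a∪c)

  ∣[a∪c]∩P∣≤rank-J∘P : ∀ {a c} → Bases a c → ∣ (a ∪ c) ∩ P ∣ ≤ rank (restrict J P)
  ∣[a∪c]∩P∣≤rank-J∘P Bac =
    let d , Md , a∪c⊆d = maximalIn-above JoinFamily (join-family⁺ Bac)
    in ≤-trans (p⊆q⇒∣p∣≤∣q∣ (⊆-∩ (⊆-trans (p∩q⊆p _ P) a∪c⊆d) (p∩q⊆q _ P)))
               (∣∣≤rank-maximalIn P RestrictFamily (imageOf⁺ (isBase J) (_∩ P) Md))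

  rank-J∘P-attained : ∃₂ λ a c → Bases a c × rank (restrict J P) ≡ ∣ (a ∪ c) ∩ P ∣
  rank-J∘P-attained =
    let d₀ , Md₀ , _       = maximalIn-above JoinFamily (join-family⁺ Bases₀)
        m , Fm , rank≡     = rank-maximalIn-attained P RestrictFamily (imageOf⁺ (isBase J) (_∩ P) Md₀)
        d , Md , d∩P≡m     = imageOf⁻ (isBase J) (_∩ P) Fm
        a , c , Bac , d≡a∪c = join-family⁻ (proj₁ (maximalIn⁻ JoinFamily Md))
    in a , c , Bac , trans rank≡ (cong ∣_∣ (trans (sym d∩P≡m) (cong (_∩ P) d≡a∪c)))

  minimal-meet-complement : ∀ {x} → T (minimalIn MeetFamily x) → MaximalIndependentIn G (G ─ x)
  minimal-meet-complement {x} Mx = co-independent Bac (⊆-reflexive G─x≡co) , p─q⊆p G x , maximal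
    where
    Fx-minimal = minimalIn⁻ MeetFamily Mx
    decomposed = meet-family⁻ (proj₁ Fx-minimal)
    Bac = proj₁ (proj₂ (proj₂ decomposed))
    G─x≡co : G ─ x ≡ co _ _
    G─x≡co = trans (cong (G ─_) (proj₂ (proj₂ (proj₂ decomposed)))) (co-meet Bac)
    maximal : ∀ {Y} → U-Independent Y → Y ⊆ G → G ─ x ⊆ Y → Y ⊆ G ─ x
    maximal {Y} iY _ G─x⊆Y = ⊆-trans Y⊆G─meet′ (─-antimono x⊆meet′)
      where
      a′c′ = independent⇒⊆co iY
      Bac′ = proj₁ (proj₂ (proj₂ a′c′))
      Y⊆G─meet′ : Y ⊆ G ─ meet _ _
      Y⊆G─meet′ = ⊆-trans (proj₂ (proj₂ (proj₂ a′c′))) (⊆-reflexive (sym (co-meet Bac′)))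
      x⊆meet′ : x ⊆ meet _ _
      x⊆meet′ = proj₂ Fx-minimal _ (meet-family⁺ Bac′) (─-reflects-⊆ (⊆-trans G─x⊆Y Y⊆G─meet′) (⊆G _))

  ∣minimal-meet∣≤ : ∀ {x a′ c′} → T (minimalIn MeetFamily x) → Bases a′ c′ → ∣ x ∣ ≤ ∣ meet a′ c′ ∣
  ∣minimal-meet∣≤ {x} {a′} {c′} Mx Bac′ =
    subst₂ _≤_ (cong ∣_∣ (p─[p─q]≡q G x (⊆G x))) (cong ∣_∣ (p─[p─q]≡q G (meet a′ c′) (⊆G _)))
    (─-antitone-∣∣ (p─q⊆p G _) (p─q⊆p G x)
      (maximal-independent-is-largest (minimal-meet-complement Mx)
        (co-independent Bac′ (⊆-reflexive (co-meet Bac′))) (p─q⊆p G _)))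

  rank-W-attained : ∃₂ λ a c → Bases a c × rank W ≡ ∣ meet a c ∣ ×
                    (∀ {a′ c′} → Bases a′ c′ → ∣ meet a c ∣ ≤ ∣ meet a′ c′ ∣)
  rank-W-attained =
    let x , Mx , rank≡      = rank-attained W (proj₁ (proj₂ (minimalIn-below MeetFamily (meet-family⁺ Bases₀))))
        a , c , Bac , x≡meet = meet-family⁻ (proj₁ (minimalIn⁻ MeetFamily Mx))
    in a , c , Bac , trans rank≡ (cong ∣_∣ x≡meet) ,
       subst (λ z → ∀ {a′ c′} → Bases a′ c′ → ∣ z ∣ ≤ ∣ meet a′ c′ ∣) x≡meet (∣minimal-meet∣≤ Mx)

  contract-family⁺ : ∀ {x} → T (minimalIn MeetFamily x) → T (ContractFamily ((G ─ x) ∩ P))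
  contract-family⁺ {x} Mx =
    imageOf⁺ (isBase (dual W)) (_∩ P)
      (dual-base⁺ W (p─q⊆p G x) (subst (T ∘ isBase W) (sym (p─[p─q]≡q G x (⊆G x))) Mx))

  contract-family⁻ : ∀ {m} → T (ContractFamily m) → ∃₂ λ a c → Bases a c × m ≡ (G ─ meet a c) ∩ P
  contract-family⁻ {m} Fm =
    let d , Dd , d∩P≡m      = imageOf⁻ (isBase (dual W)) (_∩ P) {m} Fm
        x , Mx , d≡G─x      = dual-base-is W {d} Dd
        a , c , Bac , x≡meet = meet-family⁻ (proj₁ (minimalIn⁻ MeetFamily Mx))
    in a , c , Bac , trans (sym d∩P≡m) (cong (_∩ P) (trans d≡G─x (cong (G ─_) x≡meet)))

  maximal-contract-family : ∀ {m} → T (maximalIn ContractFamily m) → MaximalIndependentIn P m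
  maximal-contract-family {m} Mm = co-independent Bac m⊆co , m⊆P , maximal
    where
    Fm-maximal = maximalIn⁻ ContractFamily Mm
    decomposed = contract-family⁻ (proj₁ Fm-maximal)
    Bac = proj₁ (proj₂ (proj₂ decomposed))
    m≡ : m ≡ (G ─ meet _ _) ∩ P
    m≡ = proj₂ (proj₂ (proj₂ decomposed))
    m⊆co : m ⊆ co _ _
    m⊆co = ⊆-trans (⊆-reflexive m≡) (⊆-trans (p∩q⊆p _ P) (⊆-reflexive (co-meet Bac)))
    m⊆P : m ⊆ P
    m⊆P = ⊆-trans (⊆-reflexive m≡) (p∩q⊆q _ P)
    maximal : ∀ {Y} → U-Independent Y → Y ⊆ P → m ⊆ Y → Y ⊆ m
    maximal {Y} iY Y⊆P m⊆Y = ⊆-trans Y⊆m′ (proj₂ Fm-maximal _ (contract-family⁺ Mw) (⊆-trans m⊆Y Y⊆m′))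
      where
      a′c′ = independent⇒⊆co iY
      Bac′ = proj₁ (proj₂ (proj₂ a′c′))
      w-below = minimalIn-below MeetFamily (meet-family⁺ Bac′)
      Mw = proj₁ (proj₂ w-below)
      Y⊆m′ : Y ⊆ (G ─ proj₁ w-below) ∩ P
      Y⊆m′ = ⊆-∩ (⊆-trans (proj₂ (proj₂ (proj₂ a′c′)))
                   (⊆-trans (⊆-reflexive (sym (co-meet Bac′))) (─-antimono (proj₂ (proj₂ w-below))))) Y⊆P

  contract-base⁻ : ∀ {k} → T (isBase (contract W P) k) →
                   ∃₂ λ a c → Bases a c × k ≡ a ∩ c × (∀ {a′ c′} → Bases a′ c′ → ∣ a ∩ c ∣ ≤ ∣ a′ ∩ c′ ∣)
  contract-base⁻ {k} Bk = a , c , Bac , k≡a∩c , bound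
    where
    k⊆P = proj₁ (dual-base⁻ (restrict (dual W) P) Bk)
    Mm  = proj₂ (dual-base⁻ (restrict (dual W) P) Bk)
    decomposed = contract-family⁻ (proj₁ (maximalIn⁻ ContractFamily Mm))
    a = proj₁ decomposed
    c = proj₁ (proj₂ decomposed)
    Bac = proj₁ (proj₂ (proj₂ decomposed))
    k≡a∩c : k ≡ a ∩ c
    k≡a∩c = trans (sym (p─[p─q]≡q P k k⊆P))
                  (trans (cong (P ─_) (proj₂ (proj₂ (proj₂ decomposed)))) (P─[G─meet∩P]≡a∩c Bac))
    bound : ∀ {a′ c′} → Bases a′ c′ → ∣ a ∩ c ∣ ≤ ∣ a′ ∩ c′ ∣
    bound {a′} {c′} Bac′ =
      subst₂ _≤_ (cong ∣_∣ (trans (p─[p─q]≡q P k k⊆P) k≡a∩c)) (cong ∣_∣ (P─[G─meet∩P]≡a∩c Bac′))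
      (─-antitone-∣∣ (p∩q⊆q _ P) (p─q⊆p P k)
        (maximal-independent-is-largest (maximal-contract-family Mm)
          (co-independent Bac′ (⊆-trans (p∩q⊆p _ P) (⊆-reflexive (co-meet Bac′)))) (p∩q⊆q _ P)))

  rank-W×P-attained : ∃₂ λ a c → Bases a c × rank (contract W P) ≡ ∣ a ∩ c ∣ ×
                      (∀ {a′ c′} → Bases a′ c′ → ∣ a ∩ c ∣ ≤ ∣ a′ ∩ c′ ∣)
  rank-W×P-attained =
    let x , Mx , _               = minimalIn-below MeetFamily (meet-family⁺ Bases₀)
        m , Mm , _               = maximalIn-above ContractFamily (contract-family⁺ Mx)
        m⊆P                      = proj₁ (proj₂ (maximal-contract-family Mm))
        k , Bk , rank≡           = rank-attained (contract W P) {P ─ m} (dual-base⁺ (restrict (dual W) P) (p─q⊆p P m)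
                                     (subst (T ∘ maximalIn ContractFamily) (sym (p─[p─q]≡q P m m⊆P)) Mm))
        a , c , Bac , k≡a∩c , bound = contract-base⁻ {k} Bk
    in a , c , Bac , trans rank≡ (cong ∣_∣ k≡a∩c) , bound

  rank-J+rank-W×P : rank J + rank (contract W P) ≡ ∣ a₀ ∣ + ∣ c₀ ∣
  rank-J+rank-W×P = max+min≡const {Good = Bases} (λ a c → ∣ a ∪ c ∣) (λ a c → ∣ a ∩ c ∣)
    (λ {a} {c} Bac → trans (∣p∪q∣+∣p∩q∣≡∣p∣+∣q∣ a c) (∣a∣+∣c∣≡∣a₀∣+∣c₀∣ Bac))
    ∣a∪c∣≤rank-J rank-J-attained rank-W×P-attained

  rank-J∘P+rank-W : rank (restrict J P) + rank W ≡ ∣ a₀ ∣ + ∣ c₀ ∣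
  rank-J∘P+rank-W = max+min≡const {Good = Bases} (λ a c → ∣ (a ∪ c) ∩ P ∣) (λ a c → ∣ meet a c ∣)
    (λ Bac → trans (∣[a∪c]∩P∣+∣meet∣≡∣a∣+∣c∣ Bac) (∣a∣+∣c∣≡∣a₀∣+∣c₀∣ Bac))
    ∣[a∪c]∩P∣≤rank-J∘P rank-J∘P-attained rank-W-attained

[+a]-[+b]≡[+c]-[+d] : ∀ a b c d → a + d ≡ c + b → (+ a) - (+ b) ≡ (+ c) - (+ d)
[+a]-[+b]≡[+c]-[+d] a b c d a+d≡c+b = begin
  (+ a) - (+ b)      ≡⟨ [+m]-[+n]≡m⊖n a b ⟩
  a ⊖ b              ≡⟨ +-cancelˡ-⊖ d a b ⟨
  (d + a) ⊖ (d + b)  ≡⟨ cong₂ _⊖_ (trans (+-comm d a) (trans a+d≡c+b (+-comm c b))) (+-comm d b) ⟩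
  (b + c) ⊖ (b + d)  ≡⟨ +-cancelˡ-⊖ b c d ⟩
  c ⊖ d              ≡⟨ [+m]-[+n]≡m⊖n c d ⟨
  (+ c) - (+ d)      ∎
  where open ≡-Reasoning

lemma17 : (n : ℕ) (S P Q : Subset n) →
          Empty (S ∩ P) → Empty (P ∩ Q) → Empty (S ∩ Q) →
          S ∪ P ∪ Q ≡ ⊤ →
          (MSP : Matroid n (S ∪ P)) (MPQ : Matroid n (P ∪ Q)) →
          let J = joinSPQ S Q (sys MSP) (sys MPQ)
              W = meetSPQ S Q (sys MSP) (sys MPQ)
          in (+ rank J) - (+ rank W) ≡ (+ rank (restrict J P)) - (+ rank (contract W P))
lemma17 n S P Q S∩P≡∅ P∩Q≡∅ S∩Q≡∅ S∪P∪Q≡⊤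
  record { sys = mkSS _ isA ; ground≡ = refl ; matroid = isMatroidA }
  record { sys = mkSS _ isC ; ground≡ = refl ; matroid = isMatroidC } =
  [+a]-[+b]≡[+c]-[+d] (rank J) (rank W) (rank (restrict J P)) (rank (contract W P))
    (trans rank-J+rank-W×P (sym rank-J∘P+rank-W))
  where open Decomposition S P Q isA isC isMatroidA isMatroidC S∩P≡∅ P∩Q≡∅ S∩Q≡∅ S∪P∪Q≡⊤
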